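{- Let $w\in\Sigma_k$ and let $w'$ be its (freely) reduced form. Then $\beta(w)=\beta(w')$.
   Context: $\Sigma_k$: finite not necessarily reduced words $w=g_{i_1}^{\alpha_1}\cdots g_{i_m}^{\alpha_m}$ ($\alpha_b=\pm1$), $|w|=m$. Associate symbols $s_0,\dots,s_m$ and the trail $s_0\to\cdots\to s_m$ with $b$-th step labeled $g_{i_b}^{\alpha_b}$. A partition of $\{s_0,\dots,s_m\}$ is realizable if for all $h,l$ with $i_h=i_l$: if $\alpha_h=\alpha_l$ then $s_{h-1}\equiv s_{l-1}\iff s_h\equiv s_l$; if $\alpha_h=-\alpha_l$ then $s_{h-1}\equiv s_l\iff s_h\equiv s_{l-1}$. Its quotient graph has the blocks as vertices and, for each $b$, an edge of color $i_b$ from the block of $s_{b-1}$ to that of $s_b$ (reversed if $\alpha_b=-1$), coinciding edges identified. $\mathcal{Q}_w$ is the set of quotient graphs of realizable partitions with $s_0\equiv s_m$; $\chi(\Gamma)=e_\Gamma-v_\Gamma+1$. A set $S$ of pairs of symbols generates $\Gamma$ if the partition of $\Gamma$ is the finest realizable partition in which each pair in $S$ lies in one block. $\Gamma\in\mathcal{Q}_w$ has type A if some generating set of $\Gamma$ of minimum cardinality contains $\{s_0,s_m\}$, and type B otherwise. $\beta(w)=\min\{\chi(\Gamma):\Gamma\in\mathcal{Q}_w\text{ of type B}\}$, or $\infty$ if there is none. -}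

module Defs where

open import Data.Nat using (ℕ; zero; suc; _≤_)
open import Data.Integer as ℤ using (ℤ; +_)
open import Data.Fin as Fin using (Fin; inject₁; fromℕ)
open import Data.Fin.Properties as FinP using ()
open import Data.Bool using (Bool; true; false; not)
open import Data.Bool.Properties as BoolP using ()
open import Data.List using (List; []; _∷_; length; map; lookup; deduplicate; foldr)
open import Data.List.Relation.Unary.All using (All)
open import Data.List.Membership.Propositional using (_∈_)
open import Data.Product using (Σ; ∃; _×_; _,_; proj₁; proj₂)
open import Data.Product.Properties using (≡-dec)
open import Data.Sum using (_⊎_)
open import Data.Maybe using (Maybe; just; nothing)
open import Data.List using (allFin)
open import Relation.Nullary using (¬_; yes; no)
open import Relation.Binary.PropositionalEquality using (_≡_; _≢_)
open import Function.Bundles using (_⇔_)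

-- A letter g_i^α : colour i : Fin k, sign α (true = +1, false = -1).
Letter : ℕ → Set
Letter k = Fin k × Bool

Word : ℕ → Set
Word k = List (Letter k)

isInverse : ∀ {k} → Letter k → Letter k → Bool
isInverse (i , a) (j , b) with i Fin.≟ j | a BoolP.≟ b
... | yes _ | no _ = true
... | _     | _    = false

push : ∀ {k} → Letter k → Word k → Word k
push x [] = x ∷ []
push x (y ∷ r) with isInverse x y
... | true  = r
... | false = x ∷ y ∷ r

reduce : ∀ {k} → Word k → Word k
reduce = foldr push []

-- Symbols s_0 … s_m of a word of length m.
Sym : ∀ {k} → Word k → Set
Sym w = Fin (suc (length w))

-- Steps b = 1 … m are indexed by j : Fin m (step b = j+1).
Step : ∀ {k} → Word k → Set
Step w = Fin (length w)

colour : ∀ {k} (w : Word k) → Step w → Fin k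
colour w j = proj₁ (lookup w j)

sign : ∀ {k} (w : Word k) → Step w → Bool
sign w j = proj₂ (lookup w j)

src tgt : ∀ {k} (w : Word k) → Step w → Sym w
src w j = inject₁ j
tgt w j = Fin.suc j

s₀ sₘ : ∀ {k} (w : Word k) → Sym w
s₀ w = Fin.zero
sₘ w = fromℕ (length w)

-- A partition of the symbols, given by a block-labelling map:
-- s ≡ t  iff  P s ≡ P t.
Partition : ∀ {k} → Word k → Set
Partition w = Sym w → Sym w

Realizable : ∀ {k} (w : Word k) → Partition w → Set
Realizable w P =
  ∀ (h l : Step w) → colour w h ≡ colour w l →
    (sign w h ≡ sign w l →
       (P (src w h) ≡ P (src w l)) ⇔ (P (tgt w h) ≡ P (tgt w l)))
  × (sign w h ≡ not (sign w l) →
       (P (src w h) ≡ P (tgt w l)) ⇔ (P (tgt w h) ≡ P (src w l)))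

-- Γ ∈ Q_w  (identified with its realizable partition)
InQ : ∀ {k} (w : Word k) → Partition w → Set
InQ w P = Realizable w P × P (s₀ w) ≡ P (sₘ w)

-- Quotient graph: vertices = blocks, edges = distinct triples
-- (colour, source block, target block), reversed for α = -1.
edge : ∀ {k} (w : Word k) → Partition w → Step w → Fin k × Sym w × Sym w
edge w P j with sign w j
... | true  = colour w j , P (src w j) , P (tgt w j)
... | false = colour w j , P (tgt w j) , P (src w j)

numVertices : ∀ {k} (w : Word k) → Partition w → ℕ
numVertices w P = length (deduplicate Fin._≟_ (map P (allFin _)))

numEdges : ∀ {k} (w : Word k) → Partition w → ℕ
numEdges {k} w P =
  length (deduplicate (≡-dec Fin._≟_ (≡-dec Fin._≟_ Fin._≟_))
                      (map (edge w P) (allFin _)))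

χ : ∀ {k} (w : Word k) → Partition w → ℤ
χ w P = (+ numEdges w P ℤ.- + numVertices w P) ℤ.+ + 1

PairSet : ∀ {k} → Word k → Set
PairSet w = List (Sym w × Sym w)

Contains : ∀ {k} (w : Word k) → PairSet w → Partition w → Set
Contains w S P = All (λ st → P (proj₁ st) ≡ P (proj₂ st)) S

Refines : ∀ {k} (w : Word k) → Partition w → Partition w → Set
Refines w P Q = ∀ s t → P s ≡ P t → Q s ≡ Q t

Generates : ∀ {k} (w : Word k) → PairSet w → Partition w → Set
Generates w S P =
  Realizable w P × Contains w S P ×
  (∀ Q → Realizable w Q → Contains w S Q → Refines w P Q)

TypeA : ∀ {k} (w : Word k) → Partition w → Set
TypeA w P =
  Σ (PairSet w) λ S →
    Generates w S P
    × (∀ T → Generates w T P → length S ≤ length T)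
    × ((s₀ w , sₘ w) ∈ S ⊎ (sₘ w , s₀ w) ∈ S)

TypeB : ∀ {k} (w : Word k) → Partition w → Set
TypeB w P = ¬ TypeA w P

-- IsBeta w b : b is β(w)  (nothing = ∞)
IsBeta : ∀ {k} (w : Word k) → Maybe ℤ → Set
IsBeta w nothing = ∀ P → InQ w P → ¬ TypeB w P
IsBeta w (just c) =
  (Σ (Partition w) λ P → InQ w P × TypeB w P × χ w P ≡ c)
  × (∀ P → InQ w P → TypeB w P → c ℤ.≤ χ w P)

module Submission where

-- Since reduce w is reached from w by cancelling adjacent inverse letters
-- one pair at a time (reduce-steps), it suffices to show that a single
-- cancellation preserves β.  A word is turned into an edge-coloured graph
-- (one edge per letter, oriented by its sign relative to a reference
-- sign); realizability and χ are the same for the word and for the graph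
-- (WordGraph).  In the graph G of w the cancelled letters become two edges
-- h₁ : ι a → c and h₂ : e → c of one colour; deleting them and c, and
-- merging e into ι a, gives the graph G′ of the shorter word
-- (Cancellation).  Realizable partitions are compared by restriction to
-- the copy of G′ and by the canonical lift, which puts c where
-- realizability forces it, or into a new block.  Restriction does not
-- raise χ and lifting preserves it; both preserve membership in Q and type
-- B.  For type B, a generating set of a partition of G yields one of its
-- restriction that is no longer, and strictly shorter when c is merged
-- without being forced (restrictGenerators; by induction on the set, using
-- closures, which exist classically).

open import Level using (0ℓ)
open import Data.Bool using (Bool; true; false; not)
open import Data.Bool.Properties as BoolP using (¬-not)
open import Data.Fin as Fin using (Fin; fromℕ)
open import Data.Fin.Properties as FinP using ()
open import Data.Integer as ℤ using (ℤ; +_; _⊖_)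
open import Data.Integer.Properties as ℤP using ()
open import Data.List using (List; []; _∷_; length; map; deduplicate; allFin; _++_)
open import Data.List.Properties as ListP using ()
open import Data.List.Membership.Propositional using (_∈_; _∉_)
open import Data.List.Membership.Propositional.Properties as ∈P using ()
import Data.List.Membership.DecPropositional as DecMembership
open import Data.List.Relation.Unary.All as All using (All; []; _∷_)
open import Data.List.Relation.Unary.AllPairs using (_∷_)
open import Data.List.Relation.Unary.Any using (here; there)
open import Data.List.Relation.Unary.Unique.Propositional using (Unique)
import Data.List.Relation.Unary.Unique.DecPropositional.Properties as UniqueP
open import Data.Maybe as Maybe using (Maybe; just; nothing)
open import Data.Maybe.Properties as MaybeP using (just-injective)
open import Data.Nat using (ℕ; zero; suc; _≤_; z≤n; s≤s)
open import Data.Nat.Properties as ℕP using ()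
open import Data.Product using (Σ; _×_; _,_; proj₁; proj₂)
open import Data.Product.Properties using (≡-dec)
open import Data.Sum as Sum using (_⊎_; inj₁; inj₂)
open import Data.Vec as Vec using (Vec; tabulate)
open import Data.Vec.Properties as VecP using ()
open import Effect.Monad using (RawMonad)
open import Function using (_∘_; id)
open import Function.Bundles using (_⇔_; mk⇔; Equivalence)
import Function.Properties.Equivalence as ⇔
open import Relation.Binary.Construct.Closure.ReflexiveTransitive using (Star; ε; _◅_; _◅◅_; gmap)
open import Relation.Binary.Definitions using (DecidableEquality)
open import Relation.Binary.PropositionalEquality
  using (_≡_; _≢_; refl; sym; trans; cong; cong₂; subst; subst₂; module ≡-Reasoning)
open import Relation.Nullary using (¬_; Dec; yes; no; does; ¬?)
open import Relation.Nullary.Decidable using (dec-true; dec-false; ¬¬-excluded-middle; decidable-stable; _×-dec_)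
open import Relation.Nullary.Negation using (¬¬-Monad; contradiction)
import Defs

open Equivalence using (to; from)
open RawMonad (¬¬-Monad {0ℓ}) using (pure; _>>=_)
open ≡-Reasoning

⇔-≡-cong : ∀ {X Y : Set} {a a′ b b′ : X} {c c′ d d′ : Y} → a ≡ a′ → b ≡ b′ → c ≡ c′ → d ≡ d′ →
           (a′ ≡ b′) ⇔ (c′ ≡ d′) → (a ≡ b) ⇔ (c ≡ d)
⇔-≡-cong refl refl refl refl a≡b⇔c≡d = a≡b⇔c≡d

-- Closures of sets of pairs and several case splits
-- are only available classically, so they are carried out in the
-- double-negation monad; all final conclusions are negations or
-- decidable, hence stable.

¬¬-∀-Fin : ∀ n {P : Fin n → Set} → (∀ i → ¬ ¬ P i) → ¬ ¬ (∀ i → P i)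
¬¬-∀-Fin zero    f = pure λ ()
¬¬-∀-Fin (suc n) f =
  f Fin.zero                            >>= λ p₀ →
  ¬¬-∀-Fin n (f ∘ Fin.suc)              >>= λ pₛ →
  pure λ { Fin.zero → p₀ ; (Fin.suc i) → pₛ i }

-- A partition of Fin n is represented by a map
-- Fin n → Fin n; any map f : Fin n → A into a type with decidable
-- equality induces one with the same kernel: send i to the first index
-- carrying the value f i.

-- the first index at which f takes the value a (0 if there is none)
firstIndex : ∀ {n} {A : Set} → DecidableEquality A → (Fin (suc n) → A) → A → Fin (suc n)
firstIndex {zero}  _≟_ f a = Fin.zero
firstIndex {suc n} _≟_ f a with f Fin.zero ≟ a
... | yes _ = Fin.zero
... | no  _ = Fin.suc (firstIndex _≟_ (f ∘ Fin.suc) a)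

firstIndex-correct : ∀ {n} {A : Set} (_≟_ : DecidableEquality A) (f : Fin (suc n) → A) i →
                     f (firstIndex _≟_ f (f i)) ≡ f i
firstIndex-correct {zero}  _≟_ f Fin.zero = refl
firstIndex-correct {suc n} _≟_ f i with f Fin.zero ≟ f i
... | yes p = p
firstIndex-correct {suc n} _≟_ f Fin.zero    | no ¬p = contradiction refl ¬p
firstIndex-correct {suc n} _≟_ f (Fin.suc i) | no _  = firstIndex-correct _≟_ (f ∘ Fin.suc) i

canonical : ∀ {n} {A : Set} → DecidableEquality A → (Fin n → A) → Fin n → Fin n
canonical {suc n} _≟_ f i = firstIndex _≟_ f (f i)

canonical-≡⇒ : ∀ {n} {A : Set} (_≟_ : DecidableEquality A) (f : Fin n → A) i j →
               canonical _≟_ f i ≡ canonical _≟_ f j → f i ≡ f j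
canonical-≡⇒ {suc n} _≟_ f i j p =
  trans (sym (firstIndex-correct _≟_ f i)) (trans (cong f p) (firstIndex-correct _≟_ f j))

canonical-≡⇐ : ∀ {n} {A : Set} (_≟_ : DecidableEquality A) (f : Fin n → A) i j →
               f i ≡ f j → canonical _≟_ f i ≡ canonical _≟_ f j
canonical-≡⇐ {suc n} _≟_ f i j p = cong (firstIndex _≟_ f) p

pigeonhole : ∀ {A B : Set} (xs : List B) (ys : List A) (f : B → A) → Unique xs →
             (∀ {a b} → a ∈ xs → b ∈ xs → f a ≡ f b → a ≡ b) →
             (∀ {a} → a ∈ xs → f a ∈ ys) → length xs ≤ length ys
pigeonhole []       ys f u       inj into = z≤n
pigeonhole (x ∷ xs) ys f (x∉ ∷ u) inj into with ∈P.∈-∃++ (into (here refl))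
... | ys₁ , ys₂ , refl =
  ℕP.≤-trans (s≤s (pigeonhole xs (ys₁ ++ ys₂) f u (λ a b → inj (there a) (there b)) into′))
             (ℕP.≤-reflexive (sym (ListP.length-++-sucʳ ys₁ (f x) ys₂)))
  where
  into′ : ∀ {a} → a ∈ xs → f a ∈ ys₁ ++ ys₂
  into′ {a} a∈ with ∈P.∈-++⁻ ys₁ (into (there a∈))
  ... | inj₁ p         = ∈P.∈-++⁺ˡ p
  ... | inj₂ (here p)  = contradiction (inj (here refl) (there a∈) (sym p)) (All.lookup x∉ a∈)
  ... | inj₂ (there p) = ∈P.∈-++⁺ʳ ys₁ p

module Distinct {A : Set} (_≟_ : DecidableEquality A) where

  distinct : List A → ℕ
  distinct xs = length (deduplicate _≟_ xs)

  _⊆_ : List A → List A → Set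
  xs ⊆ ys = ∀ {z} → z ∈ xs → z ∈ ys

  private
    unique : ∀ xs → Unique (deduplicate _≟_ xs)
    unique = UniqueP.deduplicate-! _≟_

    dedup⁺ : ∀ {xs z} → z ∈ xs → z ∈ deduplicate _≟_ xs
    dedup⁺ = ∈P.∈-deduplicate⁺ _≟_

    dedup⁻ : ∀ {xs z} → z ∈ deduplicate _≟_ xs → z ∈ xs
    dedup⁻ {xs} = ∈P.∈-deduplicate⁻ _≟_ xs

  distinct-mono : ∀ xs ys → xs ⊆ ys → distinct xs ≤ distinct ys
  distinct-mono xs ys xs⊆ys =
    pigeonhole (deduplicate _≟_ xs) (deduplicate _≟_ ys) id (unique xs)
               (λ _ _ e → e) (dedup⁺ ∘ xs⊆ys ∘ dedup⁻)

  distinct-cong : ∀ xs ys → xs ⊆ ys → ys ⊆ xs → distinct xs ≡ distinct ys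
  distinct-cong xs ys p q = ℕP.≤-antisym (distinct-mono xs ys p) (distinct-mono ys xs q)

  distinct-∷-∈ : ∀ e xs → e ∈ xs → distinct (e ∷ xs) ≡ distinct xs
  distinct-∷-∈ e xs e∈ = distinct-cong (e ∷ xs) xs (λ { (here refl) → e∈ ; (there p) → p }) there

  distinct-∷-∉ : ∀ e xs → e ∉ xs → distinct (e ∷ xs) ≡ suc (distinct xs)
  distinct-∷-∉ e xs e∉ = ℕP.≤-antisym upper lower
    where
    upper : distinct (e ∷ xs) ≤ suc (distinct xs)
    upper = pigeonhole (deduplicate _≟_ (e ∷ xs)) (e ∷ deduplicate _≟_ xs) id (unique (e ∷ xs))
                       (λ _ _ q → q) (λ p → into (dedup⁻ {e ∷ xs} p))
      where
      into : ∀ {z} → z ∈ e ∷ xs → z ∈ e ∷ deduplicate _≟_ xs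
      into (here p)  = here p
      into (there p) = there (dedup⁺ p)
    lower : suc (distinct xs) ≤ distinct (e ∷ xs)
    lower = pigeonhole (e ∷ deduplicate _≟_ xs) (deduplicate _≟_ (e ∷ xs)) id
              (All.tabulate (λ z∈ e≡z → e∉ (subst (_∈ xs) (sym e≡z) (dedup⁻ z∈))) ∷ unique xs)
              (λ _ _ q → q)
              (λ { (here p) → dedup⁺ {e ∷ xs} (here p) ; (there p) → dedup⁺ {e ∷ xs} (there (dedup⁻ p)) })

∈-map-kernel : ∀ {X A B : Set} {x : X} {xs : List X} (f : X → A) (g : X → B) →
               (∀ {a b} → a ∈ x ∷ xs → b ∈ x ∷ xs → (f a ≡ f b) ⇔ (g a ≡ g b)) →
               f x ∈ map f xs → g x ∈ map g xs
∈-map-kernel {xs = xs} f g K p with ∈P.∈-map⁻ f p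
... | y , y∈ , e = subst (_∈ map g xs) (sym (to (K (here refl) (there y∈)) e)) (∈P.∈-map⁺ g y∈)

distinct-map-kernel :
  ∀ {X A B : Set} (_≟A_ : DecidableEquality A) (_≟B_ : DecidableEquality B)
  (xs : List X) (f : X → A) (g : X → B) →
  (∀ {a b} → a ∈ xs → b ∈ xs → (f a ≡ f b) ⇔ (g a ≡ g b)) →
  Distinct.distinct _≟A_ (map f xs) ≡ Distinct.distinct _≟B_ (map g xs)
distinct-map-kernel _≟A_ _≟B_ []       f g K = refl
distinct-map-kernel _≟A_ _≟B_ (x ∷ xs) f g K
  with DecMembership._∈?_ _≟A_ (f x) (map f xs)
... | yes fx∈ = begin
  DA.distinct (f x ∷ map f xs) ≡⟨ DA.distinct-∷-∈ (f x) (map f xs) fx∈ ⟩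
  DA.distinct (map f xs)       ≡⟨ IH ⟩
  DB.distinct (map g xs)       ≡⟨ DB.distinct-∷-∈ (g x) (map g xs) (∈-map-kernel f g K fx∈) ⟨
  DB.distinct (g x ∷ map g xs) ∎
  where
  module DA = Distinct _≟A_
  module DB = Distinct _≟B_
  IH = distinct-map-kernel _≟A_ _≟B_ xs f g (λ a b → K (there a) (there b))
... | no fx∉ = begin
  DA.distinct (f x ∷ map f xs) ≡⟨ DA.distinct-∷-∉ (f x) (map f xs) fx∉ ⟩
  suc (DA.distinct (map f xs)) ≡⟨ cong suc IH ⟩
  suc (DB.distinct (map g xs)) ≡⟨ DB.distinct-∷-∉ (g x) (map g xs) gx∉ ⟨
  DB.distinct (g x ∷ map g xs) ∎
  where
  module DA = Distinct _≟A_
  module DB = Distinct _≟B_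
  IH = distinct-map-kernel _≟A_ _≟B_ xs f g (λ a b → K (there a) (there b))
  gx∉ : g x ∉ map g xs
  gx∉ = fx∉ ∘ ∈-map-kernel g f (λ a b → mk⇔ (from (K a b)) (to (K a b)))

-- The definitions of Q_w, generating sets, types A/B and β only use a
-- realizability predicate on partitions of a finite set of symbols, the
-- two end symbols and χ, so they make sense for an arbitrary such setting.
record Setting : Set₁ where
  field
    N     : ℕ
    Real  : (Fin N → Fin N) → Set
    first : Fin N
    last  : Fin N
    chi   : (Fin N → Fin N) → ℤ

module Beta (S : Setting) where
  open Setting S public

  Part : Set
  Part = Fin N → Fin N

  InQ : Part → Set
  InQ P = Real P × P first ≡ P last

  Pairs : Set
  Pairs = List (Fin N × Fin N)

  Contains : Pairs → Part → Set
  Contains T P = All (λ st → P (proj₁ st) ≡ P (proj₂ st)) T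

  Refines : Part → Part → Set
  Refines P Q = ∀ s t → P s ≡ P t → Q s ≡ Q t

  Generates : Pairs → Part → Set
  Generates T P = Real P × Contains T P × (∀ Q → Real Q → Contains T Q → Refines P Q)

  EndPair : Pairs → Set
  EndPair T = (first , last) ∈ T ⊎ (last , first) ∈ T

  TypeA : Part → Set
  TypeA P = Σ Pairs λ T → Generates T P × (∀ T′ → Generates T′ P → length T ≤ length T′) × EndPair T

  TypeB : Part → Set
  TypeB P = ¬ TypeA P

  IsBeta : Maybe ℤ → Set
  IsBeta nothing  = ∀ P → InQ P → ¬ TypeB P
  IsBeta (just c) = (Σ Part λ P → InQ P × TypeB P × chi P ≡ c)
                  × (∀ P → InQ P → TypeB P → c ℤ.≤ chi P)

  generates-refines : ∀ {T P Q} → Generates T P → Real Q → Contains T Q → Refines P Q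
  generates-refines (_ , _ , minimal) = minimal _

  generates-replace : ∀ {p p̃ T P} →
                      (∀ Q → Real Q → Contains T Q → (Q (proj₁ p) ≡ Q (proj₂ p)) ⇔ (Q (proj₁ p̃) ≡ Q (proj₂ p̃))) →
                      Generates (p ∷ T) P → Generates (p̃ ∷ T) P
  generates-replace p⇔p̃ (rP , (p∈P ∷ cP) , minimal) =
    rP , to (p⇔p̃ _ rP cP) p∈P ∷ cP , λ { Q rQ (p̃∈Q ∷ cQ) → minimal Q rQ (from (p⇔p̃ Q rQ cQ) p̃∈Q ∷ cQ) }

  refines-contains : ∀ {P Q} T → Refines P Q → Contains T P → Contains T Q
  refines-contains []            P≤Q []       = []
  refines-contains ((s , t) ∷ T) P≤Q (p ∷ ps) = P≤Q s t p ∷ refines-contains T P≤Q ps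

record Comparison (S T : Setting) : Set where
  private
    module S = Beta S
    module T = Beta T
  field
    restrict       : S.Part → T.Part
    lift           : T.Part → S.Part
    restrict-InQ   : ∀ P → S.InQ P → T.InQ (restrict P)
    restrict-TypeB : ∀ P → S.InQ P → S.TypeB P → T.TypeB (restrict P)
    restrict-chi   : ∀ P → S.InQ P → T.chi (restrict P) ℤ.≤ S.chi P
    lift-InQ       : ∀ Q → T.InQ Q → S.InQ (lift Q)
    lift-TypeB     : ∀ Q → T.InQ Q → T.TypeB Q → S.TypeB (lift Q)
    lift-chi       : ∀ Q → T.InQ Q → S.chi (lift Q) ≡ T.chi Q

β-transfer : ∀ {S T} → Comparison S T → ∀ b → Beta.IsBeta S b ⇔ Beta.IsBeta T b
β-transfer {S} {T} C nothing = mk⇔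
  (λ none Q q b → none (lift Q) (lift-InQ Q q) (lift-TypeB Q q b))
  (λ none P p b → none (restrict P) (restrict-InQ P p) (restrict-TypeB P p b))
  where open Comparison C
β-transfer {S} {T} C (just c) = mk⇔ forward backward
  where
  open Comparison C
  module S = Beta S
  module T = Beta T

  forward : S.IsBeta (just c) → T.IsBeta (just c)
  forward ((P , p , b , χP≡c) , minimal) = (restrict P , rp , rb , χ≡c) , minimal′
    where
    rp = restrict-InQ P p
    rb = restrict-TypeB P p b
    minimal′ : ∀ Q → T.InQ Q → T.TypeB Q → c ℤ.≤ T.chi Q
    minimal′ Q q b′ = subst (c ℤ.≤_) (lift-chi Q q) (minimal (lift Q) (lift-InQ Q q) (lift-TypeB Q q b′))
    χ≡c : T.chi (restrict P) ≡ c
    χ≡c = ℤP.≤-antisym (subst (T.chi (restrict P) ℤ.≤_) χP≡c (restrict-chi P p)) (minimal′ _ rp rb)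

  backward : T.IsBeta (just c) → S.IsBeta (just c)
  backward ((Q , q , b , χQ≡c) , minimal) =
    (lift Q , lift-InQ Q q , lift-TypeB Q q b , trans (lift-chi Q q) χQ≡c) ,
    λ P p b′ → ℤP.≤-trans (minimal (restrict P) (restrict-InQ P p) (restrict-TypeB P p b′)) (restrict-chi P p)

module EquivalentSettings {N : ℕ} {first last : Fin N} {R₁ R₂ : (Fin N → Fin N) → Set}
                          {χ₁ χ₂ : (Fin N → Fin N) → ℤ}
                          (R₁⇔R₂ : ∀ P → R₁ P ⇔ R₂ P) (χ₁≡χ₂ : ∀ P → R₁ P → χ₁ P ≡ χ₂ P) where
  S₁ S₂ : Setting
  S₁ = record { N = N ; Real = R₁ ; first = first ; last = last ; chi = χ₁ }
  S₂ = record { N = N ; Real = R₂ ; first = first ; last = last ; chi = χ₂ }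
  module B₁ = Beta S₁
  module B₂ = Beta S₂

  private
    generates₁₂ : ∀ {T P} → B₁.Generates T P → B₂.Generates T P
    generates₁₂ (r , c , m) = to (R₁⇔R₂ _) r , c , λ Q r₂ → m Q (from (R₁⇔R₂ Q) r₂)

    generates₂₁ : ∀ {T P} → B₂.Generates T P → B₁.Generates T P
    generates₂₁ (r , c , m) = from (R₁⇔R₂ _) r , c , λ Q r₁ → m Q (to (R₁⇔R₂ Q) r₁)

    typeA₂₁ : ∀ P → B₂.TypeA P → B₁.TypeA P
    typeA₂₁ P (T , g , m , e) = T , generates₂₁ g , (λ T′ g′ → m T′ (generates₁₂ g′)) , e

    typeA₁₂ : ∀ P → B₁.TypeA P → B₂.TypeA P
    typeA₁₂ P (T , g , m , e) = T , generates₁₂ g , (λ T′ g′ → m T′ (generates₂₁ g′)) , e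

  comparison : Comparison S₁ S₂
  comparison = record
    { restrict       = λ P → P
    ; lift           = λ P → P
    ; restrict-InQ   = λ P (r , e) → to (R₁⇔R₂ P) r , e
    ; restrict-TypeB = λ P _ b a → b (typeA₂₁ P a)
    ; restrict-chi   = λ P (r , _) → ℤP.≤-reflexive (sym (χ₁≡χ₂ P r))
    ; lift-InQ       = λ P (r , e) → from (R₁⇔R₂ P) r , e
    ; lift-TypeB     = λ P _ b a → b (typeA₁₂ P a)
    ; lift-chi       = λ P (r , _) → χ₁≡χ₂ P (from (R₁⇔R₂ P) r)
    }

-- A decidable equivalence relation on Fin n is the kernel of a partition
-- map: label s by its row of truth values and take canonical labels.
module KernelOf {n : ℕ} (_~_ : Fin n → Fin n → Set) (_~?_ : ∀ s t → Dec (s ~ t))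
                (~-refl : ∀ {s} → s ~ s) (~-sym : ∀ {s t} → s ~ t → t ~ s)
                (~-trans : ∀ {s t u} → s ~ t → t ~ u → s ~ u) where

  row : Fin n → Vec Bool n
  row s = tabulate (λ t → does (s ~? t))

  partition : Fin n → Fin n
  partition = canonical (VecP.≡-dec BoolP._≟_) row

  row-≡ : ∀ {s t} → s ~ t → row s ≡ row t
  row-≡ {s} {t} s~t = VecP.tabulate-cong agree
    where
    agree : ∀ u → does (s ~? u) ≡ does (t ~? u)
    agree u with t ~? u
    ... | yes t~u = dec-true  (s ~? u) (~-trans s~t t~u)
    ... | no  t≁u = dec-false (s ~? u) (λ s~u → t≁u (~-trans (~-sym s~t) s~u))

  does-row : ∀ s t → Vec.lookup (row s) t ≡ does (s ~? t)
  does-row s t = VecP.lookup∘tabulate (λ u → does (s ~? u)) t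

  row-≡⁻ : ∀ {s t} → row s ≡ row t → s ~ t
  row-≡⁻ {s} {t} e = witness (s ~? t) (begin
    does (s ~? t)          ≡⟨ does-row s t ⟨
    Vec.lookup (row s) t   ≡⟨ cong (λ v → Vec.lookup v t) e ⟩
    Vec.lookup (row t) t   ≡⟨ does-row t t ⟩
    does (t ~? t)          ≡⟨ dec-true (t ~? t) ~-refl ⟩
    true                   ∎)
    where
    witness : ∀ {A : Set} (a? : Dec A) → does a? ≡ true → A
    witness (yes a) _  = a
    witness (no _)  ()

  kernel : ∀ s t → (partition s ≡ partition t) ⇔ (s ~ t)
  kernel s t = mk⇔ (λ p → row-≡⁻ (canonical-≡⇒ _ row s t p)) (λ s~t → canonical-≡⇐ _ row s t (row-≡ s~t))

-- Words give such graphs,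
-- and free cancellation is an operation on them.
record Graph (k : ℕ) : Set where
  field
    n m   : ℕ
    col   : Fin m → Fin k
    start : Fin m → Fin n
    end   : Fin m → Fin n
    first : Fin n
    last  : Fin n

-- edges of a quotient graph: (colour, start block, end block)
Triple : ℕ → ℕ → Set
Triple k n = Fin k × Fin n × Fin n

_≟-triple_ : ∀ {k n} → DecidableEquality (Triple k n)
_≟-triple_ = ≡-dec Fin._≟_ (≡-dec Fin._≟_ Fin._≟_)

triple-≡ : ∀ {k n} {a b : Fin k} {x y u v : Fin n} → a ≡ b → x ≡ y → u ≡ v → (a , x , u) ≡ (b , y , v)
triple-≡ refl refl refl = refl

triple-≡⁻ : ∀ {k n} {a b : Fin k} {x y u v : Fin n} → (a , x , u) ≡ (b , y , v) → a ≡ b × x ≡ y × u ≡ v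
triple-≡⁻ refl = refl , refl , refl

euler : ℕ → ℕ → ℤ
euler e v = (+ e ℤ.- + v) ℤ.+ + 1

euler-suc : ∀ e v → euler (suc e) (suc v) ≡ euler e v
euler-suc e v = cong (ℤ._+ + 1) (begin
  + suc e ℤ.- + suc v ≡⟨ ℤP.m-n≡m⊖n (suc e) (suc v) ⟩
  suc e ⊖ suc v       ≡⟨ ℤP.[1+m]⊖[1+n]≡m⊖n e v ⟩
  e ⊖ v               ≡⟨ ℤP.m-n≡m⊖n e v ⟨
  + e ℤ.- + v         ∎)

euler-mono : ∀ e v → euler e v ℤ.≤ euler (suc e) v
euler-mono e v = ℤP.+-monoˡ-≤ (+ 1)
  (subst₂ ℤ._≤_ (sym (ℤP.m-n≡m⊖n e v)) (sym (ℤP.m-n≡m⊖n (suc e) v)) (ℤP.⊖-monoˡ-≤ v (ℕP.n≤1+n e)))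

module GraphTheory {k : ℕ} (G : Graph k) where
  open Graph G public

  RealOn : ∀ {A : Set} → (Fin n → A) → Set
  RealOn f = ∀ h l → col h ≡ col l → (f (start h) ≡ f (start l)) ⇔ (f (end h) ≡ f (end l))

  Real : (Fin n → Fin n) → Set
  Real = RealOn

  edge : (Fin n → Fin n) → Fin m → Triple k n
  edge P j = col j , P (start j) , P (end j)

  #vertices : (Fin n → Fin n) → ℕ
  #vertices P = Distinct.distinct Fin._≟_ (map P (allFin n))

  #edges : (Fin n → Fin n) → ℕ
  #edges P = Distinct.distinct _≟-triple_ (map (edge P) (allFin m))

  χ : (Fin n → Fin n) → ℤ
  χ P = euler (#edges P) (#vertices P)

  setting : Setting
  setting = record { N = n ; Real = Real ; first = first ; last = last ; chi = χ }

  open Beta setting public hiding (N; Real; first; last; chi)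

  SameKernel : ∀ {A B : Set} → (Fin n → A) → (Fin n → B) → Set
  SameKernel f g = ∀ s t → (f s ≡ f t) ⇔ (g s ≡ g t)

  same-Real : ∀ {A B : Set} {f : Fin n → A} {g : Fin n → B} → SameKernel f g → RealOn f → RealOn g
  same-Real f~g rf h l c = mk⇔
    (λ e → to (f~g _ _) (to (rf h l c) (from (f~g _ _) e)))
    (λ e → to (f~g _ _) (from (rf h l c) (from (f~g _ _) e)))

  canonical-Real : ∀ {A : Set} (_≟_ : DecidableEquality A) (f : Fin n → A) → RealOn f → Real (canonical _≟_ f)
  canonical-Real _≟_ f = same-Real (λ s t → mk⇔ (canonical-≡⇐ _≟_ f s t) (canonical-≡⇒ _≟_ f s t))

  same-Generates : ∀ {T} {P Q : Part} → SameKernel P Q → Generates T P → Generates T Q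
  same-Generates {T} P~Q (rP , cP , minimal) =
    same-Real P~Q rP , refines-contains T (λ s t → to (P~Q s t)) cP ,
    λ R rR cR s t e → minimal R rR cR s t (from (P~Q s t) e)

  same-χ : ∀ {P Q : Part} → SameKernel P Q → χ P ≡ χ Q
  same-χ {P} {Q} P~Q = cong₂ euler same-#edges same-#vertices
    where
    same-#vertices : #vertices P ≡ #vertices Q
    same-#vertices = distinct-map-kernel Fin._≟_ Fin._≟_ (allFin n) P Q (λ {a} {b} _ _ → P~Q a b)
    edge-kernel : ∀ a b → (edge P a ≡ edge P b) ⇔ (edge Q a ≡ edge Q b)
    edge-kernel a b = mk⇔
      (λ e → let (c , s , t) = triple-≡⁻ e in triple-≡ c (to (P~Q _ _) s) (to (P~Q _ _) t))
      (λ e → let (c , s , t) = triple-≡⁻ e in triple-≡ c (from (P~Q _ _) s) (from (P~Q _ _) t))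
    same-#edges : #edges P ≡ #edges Q
    same-#edges = distinct-map-kernel _≟-triple_ _≟-triple_ (allFin m) (edge P) (edge Q)
                    (λ {a} {b} _ _ → edge-kernel a b)

  -- Every set of pairs generates a partition (classically): its blocks are
  -- the classes of "identified by every realizable partition containing T".
  module Closure (T : Pairs) where
    _~_ : Fin n → Fin n → Set
    s ~ t = ∀ Q → Real Q → Contains T Q → Q s ≡ Q t

    contains : ∀ (P : Part) → (∀ s t → s ~ t → P s ≡ P t) →
               ∀ T′ → (∀ {Q} → Contains T Q → Contains T′ Q) → Contains T′ P
    contains P ~⇒≡ []             _   = []
    contains P ~⇒≡ ((s , t) ∷ T′) sub =
      ~⇒≡ s t (λ Q _ c → All.head (sub c)) ∷ contains P ~⇒≡ T′ (All.tail ∘ sub)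

    generated : (∀ s t → Dec (s ~ t)) → Σ Part (Generates T)
    generated _~?_ = partition , real , contains partition ~⇒≡ T (λ c → c) , λ Q rQ cQ s t e → ≡⇒~ s t e Q rQ cQ
      where
      open KernelOf _~_ _~?_ (λ _ _ _ → refl) (λ p Q r c → sym (p Q r c)) (λ p q Q r c → trans (p Q r c) (q Q r c))
      ~⇒≡ = λ s t → from (kernel s t)
      ≡⇒~ = λ s t → to (kernel s t)
      real : Real partition
      real h l c = mk⇔
        (λ e → ~⇒≡ _ _ (λ Q rQ cQ → to   (rQ h l c) (≡⇒~ _ _ e Q rQ cQ)))
        (λ e → ~⇒≡ _ _ (λ Q rQ cQ → from (rQ h l c) (≡⇒~ _ _ e Q rQ cQ)))

    closure : ¬ ¬ Σ Part (Generates T)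
    closure = do
      decide ← ¬¬-∀-Fin n (λ s → ¬¬-∀-Fin n (λ t → ¬¬-excluded-middle))
      pure (generated decide)

-- G′ arises from G by cancelling a pair: G has two edges h₁ : ι a → c
-- and h₂ : e → c of the same colour x, and G′ is obtained by deleting
-- them together with c and merging e into ι a.  The map ι embeds the
-- symbols of G′, σ projects back; every other edge of G is the image
-- ιₑ j of an edge of G′, whose endpoints lie over those of j (using e in
-- place of ι a is allowed).
record Cancellation {k : ℕ} (G G′ : Graph k) : Set where
  open Graph G
  open Graph G′ renaming (n to n′; m to m′; col to col′; start to start′; end to end′;
                          first to first′; last to last′)
  field
    ι       : Fin n′ → Fin n
    σ       : Fin n → Fin n′
    a       : Fin n′
    c e     : Fin n
    ιₑ      : Fin m′ → Fin m
    h₁ h₂   : Fin m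
    x       : Fin k
    σ∘ι     : ∀ t → σ (ι t) ≡ t
    σ-e     : σ e ≡ a
    ι≢c     : ∀ t → ι t ≢ c
    e≢c     : e ≢ c
    symbols : ∀ s → s ≡ c ⊎ s ≡ e ⊎ s ≡ ι (σ s)
    edges   : ∀ h → h ≡ h₁ ⊎ h ≡ h₂ ⊎ Σ (Fin m′) (λ j → h ≡ ιₑ j)
    col-h₁  : col h₁ ≡ x
    col-h₂  : col h₂ ≡ x
    col-ιₑ  : ∀ j → col (ιₑ j) ≡ col′ j
    start-h₁ : start h₁ ≡ ι a
    end-h₁   : end h₁ ≡ c
    start-h₂ : start h₂ ≡ e
    end-h₂   : end h₂ ≡ c
    start-ιₑ : ∀ j → start (ιₑ j) ≡ ι (start′ j) ⊎ (start (ιₑ j) ≡ e × start′ j ≡ a)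
    end-ιₑ   : ∀ j → end (ιₑ j) ≡ ι (end′ j) ⊎ (end (ιₑ j) ≡ e × end′ j ≡ a)
    first-ι  : first ≡ ι first′ ⊎ (first ≡ e × first′ ≡ a)
    last-ι   : last ≡ ι last′ ⊎ (last ≡ e × last′ ≡ a)

module CancellationTheory {k : ℕ} (G G′ : Graph k) (C : Cancellation G G′) where
  module 𝒢  = GraphTheory G
  module 𝒢′ = GraphTheory G′
  open Graph G
  open Graph G′ renaming (n to n′; m to m′; col to col′; start to start′; end to end′;
                          first to first′; last to last′)
  open Cancellation C

  Over : Fin n′ → Fin n → Set
  Over t s = s ≡ ι t ⊎ (s ≡ e × t ≡ a)

  σ-Over : ∀ {t s} → Over t s → σ s ≡ t
  σ-Over (inj₁ refl)          = σ∘ι _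
  σ-Over (inj₂ (refl , refl)) = σ-e

  Over-≢c : ∀ {t s} → Over t s → s ≢ c
  Over-≢c (inj₁ refl)       = ι≢c _
  Over-≢c (inj₂ (refl , _)) = e≢c

  first≢c : first ≢ c
  first≢c = Over-≢c first-ι

  last≢c : last ≢ c
  last≢c = Over-≢c last-ι

  module Collapsed {A : Set} (f : Fin n → A) (e≈a : f e ≡ f (ι a)) where
    over : ∀ {t s} → Over t s → f s ≡ f (ι t)
    over (inj₁ refl)          = refl
    over (inj₂ (refl , refl)) = e≈a

    off-c : ∀ s → s ≢ c → f s ≡ f (ι (σ s))
    off-c s s≢c with symbols s
    ... | inj₁ s≡c         = contradiction s≡c s≢c
    ... | inj₂ (inj₁ refl) = trans e≈a (cong (f ∘ ι) (sym σ-e))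
    ... | inj₂ (inj₂ p)    = cong f p

    data EdgeKind (h : Fin m) : Set where
      cancelled : col h ≡ x → f (start h) ≡ f (ι a) → f (end h) ≡ f c → EdgeKind h
      copy      : (j : Fin m′) → col h ≡ col′ j → f (start h) ≡ f (ι (start′ j)) →
                  f (end h) ≡ f (ι (end′ j)) → EdgeKind h

    edgeKind : ∀ h → EdgeKind h
    edgeKind h with edges h
    ... | inj₁ refl              = cancelled col-h₁ (cong f start-h₁) (cong f end-h₁)
    ... | inj₂ (inj₁ refl)       = cancelled col-h₂ (trans (cong f start-h₂) e≈a) (cong f end-h₂)
    ... | inj₂ (inj₂ (j , refl)) = copy j (col-ιₑ j) (over (start-ιₑ j)) (over (end-ιₑ j))

  module Realizable {A : Set} (f : Fin n → A) (rf : 𝒢.RealOn f) where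
    -- h₁ and h₂ both end at c, so they start in one block
    e≈a : f e ≡ f (ι a)
    e≈a = begin
      f e           ≡⟨ cong f start-h₂ ⟨
      f (start h₂)  ≡⟨ from (rf h₂ h₁ (trans col-h₂ (sym col-h₁))) (cong f (trans end-h₂ (sym end-h₁))) ⟩
      f (start h₁)  ≡⟨ cong f start-h₁ ⟩
      f (ι a)       ∎

    open Collapsed f e≈a public

    through-c : ∀ j → col′ j ≡ x → (f (ι a) ≡ f (ι (start′ j))) ⇔ (f c ≡ f (ι (end′ j)))
    through-c j cj = ⇔-≡-cong (cong f (sym start-h₁)) (sym (over (start-ιₑ j)))
                               (cong f (sym end-h₁)) (sym (over (end-ιₑ j)))
                               (rf h₁ (ιₑ j) (trans col-h₁ (trans (sym cj) (sym (col-ιₑ j)))))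

  restrict : 𝒢.Part → 𝒢′.Part
  restrict P = canonical Fin._≟_ (P ∘ ι)

  restrict-≡⇒ : ∀ P t₁ t₂ → restrict P t₁ ≡ restrict P t₂ → P (ι t₁) ≡ P (ι t₂)
  restrict-≡⇒ P = canonical-≡⇒ Fin._≟_ (P ∘ ι)

  restrict-≡⇐ : ∀ P t₁ t₂ → P (ι t₁) ≡ P (ι t₂) → restrict P t₁ ≡ restrict P t₂
  restrict-≡⇐ P = canonical-≡⇐ Fin._≟_ (P ∘ ι)

  restrict-Real : ∀ P → 𝒢.Real P → 𝒢′.Real (restrict P)
  restrict-Real P rP = 𝒢′.canonical-Real Fin._≟_ (P ∘ ι) real
    where
    open Realizable P rP
    real : 𝒢′.RealOn (P ∘ ι)
    real j l cjl = ⇔-≡-cong (sym (over (start-ιₑ j))) (sym (over (start-ιₑ l)))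
                            (sym (over (end-ιₑ j))) (sym (over (end-ιₑ l)))
                            (rP (ιₑ j) (ιₑ l) (trans (col-ιₑ j) (trans cjl (sym (col-ιₑ l)))))

  restrict-InQ : ∀ P → 𝒢.InQ P → 𝒢′.InQ (restrict P)
  restrict-InQ P (rP , P₀≡Pₘ) =
    restrict-Real P rP , restrict-≡⇐ P first′ last′ (trans (sym (over first-ι)) (trans P₀≡Pₘ (over last-ι)))
    where open Realizable P rP

  module _ {X Q : 𝒢.Part} (X-e≈a : X e ≡ X (ι a)) (rQ : 𝒢.Real Q) where
    private
      module X = Collapsed X X-e≈a
      module Q = Realizable Q rQ

    refines-criterion : (∀ t₁ t₂ → X (ι t₁) ≡ X (ι t₂) → Q (ι t₁) ≡ Q (ι t₂)) →
                        (∀ t → X (ι t) ≡ X c → Q (ι t) ≡ Q c) → 𝒢.Refines X Q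
    refines-criterion on-G′ at-c s₁ s₂ p with s₁ Fin.≟ c | s₂ Fin.≟ c
    ... | yes refl | yes refl = refl
    ... | yes refl | no s₂≢c  = sym (trans (Q.off-c s₂ s₂≢c) (at-c _ (trans (sym (X.off-c s₂ s₂≢c)) (sym p))))
    ... | no s₁≢c  | yes refl = trans (Q.off-c s₁ s₁≢c) (at-c _ (trans (sym (X.off-c s₁ s₁≢c)) p))
    ... | no s₁≢c  | no s₂≢c  =
      trans (Q.off-c s₁ s₁≢c) (trans (on-G′ _ _ (trans (sym (X.off-c s₁ s₁≢c)) (trans p (X.off-c s₂ s₂≢c))))
                                     (sym (Q.off-c s₂ s₂≢c)))

  map-just⁻ : ∀ {A B : Set} (f : A → B) {y} mz → Maybe.map f mz ≡ just y → Σ A λ z → mz ≡ just z × f z ≡ y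
  map-just⁻ f (just z) p = z , refl , just-injective p

  -- Lifting: a partition Γ of G′ and a choice ℓ of a block for c (that of
  -- the symbol z when ℓ = just z, a new one when ℓ = nothing) give a
  -- labelling of the symbols of G, hence a partition of G.
  module Lift (Γ : 𝒢′.Part) (ℓ : Maybe (Fin n′)) where
    label : Fin n → Maybe (Fin n′)
    label s with s Fin.≟ c
    ... | yes _ = Maybe.map Γ ℓ
    ... | no  _ = just (Γ (σ s))

    label-c : label c ≡ Maybe.map Γ ℓ
    label-c with c Fin.≟ c
    ... | yes _   = refl
    ... | no  c≢c = contradiction refl c≢c

    label-off-c : ∀ s → s ≢ c → label s ≡ just (Γ (σ s))
    label-off-c s s≢c with s Fin.≟ c
    ... | yes s≡c = contradiction s≡c s≢c
    ... | no  _   = refl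

    label-over : ∀ {t s} → Over t s → label s ≡ just (Γ t)
    label-over o = trans (label-off-c _ (Over-≢c o)) (cong (just ∘ Γ) (σ-Over o))

    label-ι : ∀ t → label (ι t) ≡ just (Γ t)
    label-ι t = label-over (inj₁ refl)

    lift : 𝒢.Part
    lift = canonical (MaybeP.≡-dec Fin._≟_) label

    lift-≡⇒ : ∀ s₁ s₂ → lift s₁ ≡ lift s₂ → label s₁ ≡ label s₂
    lift-≡⇒ = canonical-≡⇒ (MaybeP.≡-dec Fin._≟_) label

    lift-≡⇐ : ∀ s₁ s₂ → label s₁ ≡ label s₂ → lift s₁ ≡ lift s₂
    lift-≡⇐ = canonical-≡⇐ (MaybeP.≡-dec Fin._≟_) label

    lift-ι : ∀ t₁ t₂ → (lift (ι t₁) ≡ lift (ι t₂)) ⇔ (Γ t₁ ≡ Γ t₂)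
    lift-ι t₁ t₂ = mk⇔
      (λ p → just-injective (trans (sym (label-ι t₁)) (trans (lift-≡⇒ _ _ p) (label-ι t₂))))
      (λ p → lift-≡⇐ _ _ (trans (label-ι t₁) (trans (cong just p) (sym (label-ι t₂)))))

    restrict-lift : 𝒢′.SameKernel (restrict lift) Γ
    restrict-lift t₁ t₂ = mk⇔ (to (lift-ι t₁ t₂) ∘ restrict-≡⇒ lift t₁ t₂) (restrict-≡⇐ lift t₁ t₂ ∘ from (lift-ι t₁ t₂))

    lift-c≡ι⇒ : ∀ t → lift c ≡ lift (ι t) → Σ (Fin n′) λ z → ℓ ≡ just z × Γ z ≡ Γ t
    lift-c≡ι⇒ t p = map-just⁻ Γ ℓ (trans (sym label-c) (trans (lift-≡⇒ _ _ p) (label-ι t)))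

    lift-c≡ι⇐ : ∀ t z → ℓ ≡ just z → Γ z ≡ Γ t → lift c ≡ lift (ι t)
    lift-c≡ι⇐ t z refl q = lift-≡⇐ _ _ (trans label-c (trans (cong just q) (sym (label-ι t))))

    Valid : Set
    Valid = ∀ j → col′ j ≡ x → (Γ (start′ j) ≡ Γ a) ⇔ (Maybe.map Γ ℓ ≡ just (Γ (end′ j)))

    module _ (rΓ : 𝒢′.Real Γ) (valid : Valid) where
      open Collapsed label (trans (label-over (inj₂ (refl , refl))) (sym (label-ι a)))

      mixed : ∀ {h l j} → col h ≡ x → col l ≡ col′ j → col h ≡ col l →
              (just (Γ a) ≡ just (Γ (start′ j))) ⇔ (Maybe.map Γ ℓ ≡ just (Γ (end′ j)))
      mixed ch cl chl with valid _ (trans (sym cl) (trans (sym chl) ch))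
      ... | v = mk⇔ (λ p → to v (sym (just-injective p))) (λ p → cong just (sym (from v p)))

      label-Real : 𝒢.RealOn label
      label-Real h l chl with edgeKind h | edgeKind l
      ... | cancelled _ sh eh | cancelled _ sl el =
            mk⇔ (λ _ → trans eh (sym el)) (λ _ → trans sh (sym sl))
      ... | copy j cj sh eh | copy j′ cj′ sl el =
            ⇔-≡-cong (trans sh (label-ι _)) (trans sl (label-ι _)) (trans eh (label-ι _)) (trans el (label-ι _))
              (mk⇔ (cong just ∘ to (rΓ j j′ (trans (sym cj) (trans chl cj′))) ∘ just-injective)
                   (cong just ∘ from (rΓ j j′ (trans (sym cj) (trans chl cj′))) ∘ just-injective))
      ... | cancelled ch sh eh | copy j cj sl el =
            ⇔-≡-cong (trans sh (label-ι a)) (trans sl (label-ι _)) (trans eh label-c) (trans el (label-ι _))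
              (mixed ch cj chl)
      ... | copy j cj sh eh | cancelled ch sl el =
            ⇔-≡-cong (trans sh (label-ι _)) (trans sl (label-ι a)) (trans eh (label-ι _)) (trans el label-c)
              (mk⇔ (λ p → sym (to (mixed ch cj (sym chl)) (sym p))) (λ p → sym (from (mixed ch cj (sym chl)) (sym p))))

      lift-Real : 𝒢.Real lift
      lift-Real = 𝒢.canonical-Real (MaybeP.≡-dec Fin._≟_) label label-Real

    lift-refines : ∀ Q → 𝒢.Real Q → (∀ t₁ t₂ → Γ t₁ ≡ Γ t₂ → Q (ι t₁) ≡ Q (ι t₂)) →
                   (∀ z → ℓ ≡ just z → Q c ≡ Q (ι z)) → 𝒢.Refines lift Q
    lift-refines Q rQ Γ⇒Q ℓ⇒Q = refines-criterion lift-e≈a rQ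
      (λ t₁ t₂ p → Γ⇒Q t₁ t₂ (to (lift-ι t₁ t₂) p))
      (λ t p → let (z , ℓ≡z , Γz≡Γt) = lift-c≡ι⇒ t (sym p) in sym (trans (ℓ⇒Q z ℓ≡z) (Γ⇒Q z t Γz≡Γt)))
      where
      lift-e≈a : lift e ≡ lift (ι a)
      lift-e≈a = lift-≡⇐ _ _ (trans (label-over (inj₂ (refl , refl))) (sym (label-ι a)))

  -- Some x-edge of G′ starts in the block of a; realizability then forces
  -- c into the block of its end.
  Forcing : ∀ {A : Set} → (Fin n′ → A) → Set
  Forcing f = Σ (Fin m′) λ j → col′ j ≡ x × f (start′ j) ≡ f a

  forcing? : ∀ {N} (f : Fin n′ → Fin N) → Dec (Forcing f)
  forcing? f = FinP.any? (λ j → (col′ j Fin.≟ x) ×-dec (f (start′ j) Fin.≟ f a))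

  forcedBlock : ∀ {Γ : 𝒢′.Part} → Dec (Forcing Γ) → Maybe (Fin n′)
  forcedBlock (yes (j , _)) = just (end′ j)
  forcedBlock (no  _)       = nothing

  forcedBlock-just : ∀ {Γ} (d : Dec (Forcing Γ)) z → forcedBlock d ≡ just z →
                     Σ (Fin m′) λ j → col′ j ≡ x × Γ (start′ j) ≡ Γ a × z ≡ end′ j
  forcedBlock-just (yes (j , cj , sj)) z refl = j , cj , sj , refl

  forcedBlock-Valid : ∀ {Γ} → 𝒢′.Real Γ → (d : Dec (Forcing Γ)) → Lift.Valid Γ (forcedBlock d)
  forcedBlock-Valid rΓ (yes (j₀ , cj₀ , sj₀)) j cj with rΓ j₀ j (trans cj₀ (sym cj))
  ... | j₀~j = mk⇔ (λ p → cong just (to j₀~j (trans sj₀ (sym p))))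
                   (λ p → trans (sym (from j₀~j (just-injective p))) sj₀)
  forcedBlock-Valid rΓ (no ¬forcing) j cj = mk⇔ (λ p → contradiction (j , cj , p) ¬forcing) (λ ())

  extend : 𝒢′.Part → 𝒢.Part
  extend Γ = Lift.lift Γ (forcedBlock (forcing? Γ))

  extend-Real : ∀ Γ → 𝒢′.Real Γ → 𝒢.Real (extend Γ)
  extend-Real Γ rΓ = Lift.lift-Real Γ _ rΓ (forcedBlock-Valid rΓ (forcing? Γ))

  extend-InQ : ∀ Γ → 𝒢′.InQ Γ → 𝒢.InQ (extend Γ)
  extend-InQ Γ (rΓ , Γ₀≡Γₘ) = extend-Real Γ rΓ ,
    lift-≡⇐ first last (trans (label-over first-ι) (trans (cong just Γ₀≡Γₘ) (sym (label-over last-ι))))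
    where open Lift Γ (forcedBlock (forcing? Γ))

  extend-c≡ι⇒ : ∀ Γ t → extend Γ c ≡ extend Γ (ι t) →
                Σ (Fin m′) λ j → col′ j ≡ x × Γ (start′ j) ≡ Γ a × Γ (end′ j) ≡ Γ t
  extend-c≡ι⇒ Γ t p with Lift.lift-c≡ι⇒ Γ _ t p
  ... | z , forced≡z , Γz≡Γt with forcedBlock-just (forcing? Γ) z forced≡z
  ... | j , cj , sj , refl = j , cj , sj , Γz≡Γt

  -- Counting: the quotient of G consists of the quotient of the copy of
  -- G′, plus the block of c and the class of the cancelled edges (which
  -- coincide in the quotient).
  module Counting (P : 𝒢.Part) (rP : 𝒢.Real P) where
    open Realizable P rP
    private
      module DV = Distinct (Fin._≟_ {n})
      module DE = Distinct (_≟-triple_ {k} {n})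

    copyVertices : List (Fin n)
    copyVertices = map (P ∘ ι) (allFin n′)

    copyEdge : Fin m′ → Triple k n
    copyEdge j = col′ j , P (ι (start′ j)) , P (ι (end′ j))

    copyEdges : List (Triple k n)
    copyEdges = map copyEdge (allFin m′)

    cancelledEdge : Triple k n
    cancelledEdge = x , P (ι a) , P c

    #vertices-split : 𝒢.#vertices P ≡ DV.distinct (P c ∷ copyVertices)
    #vertices-split = DV.distinct-cong _ _ ⊆ ⊇
      where
      ⊆ : map P (allFin n) DV.⊆ (P c ∷ copyVertices)
      ⊆ y∈ with ∈P.∈-map⁻ P y∈
      ... | s , _ , refl with s Fin.≟ c
      ... | yes refl = here refl
      ... | no s≢c   = there (subst (_∈ copyVertices) (sym (off-c s s≢c)) (∈P.∈-map⁺ (P ∘ ι) (∈P.∈-allFin (σ s))))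
      ⊇ : (P c ∷ copyVertices) DV.⊆ map P (allFin n)
      ⊇ (here refl) = ∈P.∈-map⁺ P (∈P.∈-allFin c)
      ⊇ (there y∈) with ∈P.∈-map⁻ (P ∘ ι) y∈
      ... | t , _ , refl = ∈P.∈-map⁺ P (∈P.∈-allFin (ι t))

    #edges-split : 𝒢.#edges P ≡ DE.distinct (cancelledEdge ∷ copyEdges)
    #edges-split = DE.distinct-cong _ _ ⊆ ⊇
      where
      ⊆ : map (𝒢.edge P) (allFin m) DE.⊆ (cancelledEdge ∷ copyEdges)
      ⊆ y∈ with ∈P.∈-map⁻ (𝒢.edge P) y∈
      ... | h , _ , refl with edgeKind h
      ... | cancelled ch sh eh = here (triple-≡ ch sh eh)
      ... | copy j cj sj ej    = there (subst (_∈ copyEdges) (sym (triple-≡ cj sj ej)) (∈P.∈-map⁺ copyEdge (∈P.∈-allFin j)))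
      ⊇ : (cancelledEdge ∷ copyEdges) DE.⊆ map (𝒢.edge P) (allFin m)
      ⊇ (here refl) = subst (_∈ map (𝒢.edge P) (allFin m)) (triple-≡ col-h₁ (cong P start-h₁) (cong P end-h₁))
                            (∈P.∈-map⁺ (𝒢.edge P) (∈P.∈-allFin h₁))
      ⊇ (there y∈) with ∈P.∈-map⁻ copyEdge y∈
      ... | j , _ , refl = subst (_∈ map (𝒢.edge P) (allFin m))
                                 (triple-≡ (col-ιₑ j) (over (start-ιₑ j)) (over (end-ιₑ j)))
                                 (∈P.∈-map⁺ (𝒢.edge P) (∈P.∈-allFin (ιₑ j)))

    copy-#vertices : DV.distinct copyVertices ≡ 𝒢′.#vertices (restrict P)
    copy-#vertices = distinct-map-kernel Fin._≟_ Fin._≟_ (allFin n′) (P ∘ ι) (restrict P)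
                       (λ {t₁} {t₂} _ _ → mk⇔ (restrict-≡⇐ P t₁ t₂) (restrict-≡⇒ P t₁ t₂))

    copy-#edges : DE.distinct copyEdges ≡ 𝒢′.#edges (restrict P)
    copy-#edges = distinct-map-kernel _≟-triple_ _≟-triple_ (allFin m′) copyEdge (𝒢′.edge (restrict P))
      (λ _ _ → mk⇔
        (λ q → let (p₁ , p₂ , p₃) = triple-≡⁻ q in triple-≡ p₁ (restrict-≡⇐ P _ _ p₂) (restrict-≡⇐ P _ _ p₃))
        (λ q → let (p₁ , p₂ , p₃) = triple-≡⁻ q in triple-≡ p₁ (restrict-≡⇒ P _ _ p₂) (restrict-≡⇒ P _ _ p₃)))

    cancelled∈⇒c∈ : cancelledEdge ∈ copyEdges → P c ∈ copyVertices
    cancelled∈⇒c∈ p with ∈P.∈-map⁻ copyEdge p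
    ... | j , _ , q = subst (_∈ copyVertices) (sym (proj₂ (proj₂ (triple-≡⁻ q)))) (∈P.∈-map⁺ (P ∘ ι) (∈P.∈-allFin (end′ j)))

    private
      E′ V′ : ℕ
      E′ = 𝒢′.#edges (restrict P)
      V′ = 𝒢′.#vertices (restrict P)

    #edges-old : cancelledEdge ∈ copyEdges → 𝒢.#edges P ≡ E′
    #edges-old e∈ = trans #edges-split (trans (DE.distinct-∷-∈ _ _ e∈) copy-#edges)

    #edges-new : cancelledEdge ∉ copyEdges → 𝒢.#edges P ≡ suc E′
    #edges-new e∉ = trans #edges-split (trans (DE.distinct-∷-∉ _ _ e∉) (cong suc copy-#edges))

    #vertices-old : P c ∈ copyVertices → 𝒢.#vertices P ≡ V′
    #vertices-old v∈ = trans #vertices-split (trans (DV.distinct-∷-∈ _ _ v∈) copy-#vertices)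

    #vertices-new : P c ∉ copyVertices → 𝒢.#vertices P ≡ suc V′
    #vertices-new v∉ = trans #vertices-split (trans (DV.distinct-∷-∉ _ _ v∉) (cong suc copy-#vertices))

    -- the only case with unequal χ: a new edge class but no new vertex
    χ-restrict-≤ : 𝒢′.χ (restrict P) ℤ.≤ 𝒢.χ P
    χ-restrict-≤ with DecMembership._∈?_ _≟-triple_ cancelledEdge copyEdges | DecMembership._∈?_ Fin._≟_ (P c) copyVertices
    ... | yes e∈ | _      = ℤP.≤-reflexive (sym (cong₂ euler (#edges-old e∈) (#vertices-old (cancelled∈⇒c∈ e∈))))
    ... | no e∉  | yes v∈ = subst (𝒢′.χ (restrict P) ℤ.≤_) (sym (cong₂ euler (#edges-new e∉) (#vertices-old v∈)))
                                  (euler-mono E′ V′)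
    ... | no e∉  | no v∉  = ℤP.≤-reflexive (sym (trans (cong₂ euler (#edges-new e∉) (#vertices-new v∉)) (euler-suc E′ V′)))

    χ-restrict-≡ : (P c ∈ copyVertices → cancelledEdge ∈ copyEdges) → 𝒢.χ P ≡ 𝒢′.χ (restrict P)
    χ-restrict-≡ c∈⇒cancelled∈
      with DecMembership._∈?_ _≟-triple_ cancelledEdge copyEdges | DecMembership._∈?_ Fin._≟_ (P c) copyVertices
    ... | yes e∈ | _      = cong₂ euler (#edges-old e∈) (#vertices-old (cancelled∈⇒c∈ e∈))
    ... | no e∉  | yes v∈ = contradiction (c∈⇒cancelled∈ v∈) e∉
    ... | no e∉  | no v∉  = trans (cong₂ euler (#edges-new e∉) (#vertices-new v∉)) (euler-suc E′ V′)

  χ-restrict : ∀ P → 𝒢.InQ P → 𝒢′.χ (restrict P) ℤ.≤ 𝒢.χ P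
  χ-restrict P (rP , _) = Counting.χ-restrict-≤ P rP

  χ-extend : ∀ Γ → 𝒢′.InQ Γ → 𝒢.χ (extend Γ) ≡ 𝒢′.χ Γ
  χ-extend Γ (rΓ , _) = trans (χ-restrict-≡ c∈⇒cancelled∈) (𝒢′.same-χ restrict-lift)
    where
    P = extend Γ
    open Lift Γ (forcedBlock (forcing? Γ)) using (lift-ι; restrict-lift)
    open Counting P (extend-Real Γ rΓ)
    -- c only joins a block of G′ when forced, i.e. along an x-edge from a
    c∈⇒cancelled∈ : P c ∈ copyVertices → cancelledEdge ∈ copyEdges
    c∈⇒cancelled∈ p with ∈P.∈-map⁻ (P ∘ ι) p
    ... | t , _ , Pc≡Pt with extend-c≡ι⇒ Γ t Pc≡Pt
    ... | j , cj , sj , ej = subst (_∈ copyEdges)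
          (sym (triple-≡ (sym cj) (from (lift-ι a (start′ j)) (sym sj)) (trans Pc≡Pt (from (lift-ι t (end′ j)) (sym ej)))))
          (∈P.∈-map⁺ copyEdge (∈P.∈-allFin j))

  -- Lifting pairs of symbols of G′ to pairs of G; the end pair is sent to
  -- the end pair, so that type A can be transported.
  _≟-pair_ : (p q : Fin n′ × Fin n′) → Dec (p ≡ q)
  _≟-pair_ = ≡-dec Fin._≟_ Fin._≟_

  liftPair : Fin n′ × Fin n′ → Fin n × Fin n
  liftPair p with p ≟-pair (first′ , last′) | p ≟-pair (last′ , first′)
  ... | yes _ | _     = first , last
  ... | no _  | yes _ = last , first
  ... | no _  | no _  = ι (proj₁ p) , ι (proj₂ p)

  liftPair-Over : ∀ p → Over (proj₁ p) (proj₁ (liftPair p)) × Over (proj₂ p) (proj₂ (liftPair p))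
  liftPair-Over p with p ≟-pair (first′ , last′) | p ≟-pair (last′ , first′)
  ... | yes refl | _        = first-ι , last-ι
  ... | no _     | yes refl = last-ι , first-ι
  ... | no _     | no _     = inj₁ refl , inj₁ refl

  liftPair-first-last : liftPair (first′ , last′) ≡ (first , last)
  liftPair-first-last with (first′ , last′) ≟-pair (first′ , last′)
  ... | yes _ = refl
  ... | no ne = contradiction refl ne

  liftPair-last-first : liftPair (last′ , first′) ≡ (last , first) ⊎ liftPair (last′ , first′) ≡ (first , last)
  liftPair-last-first with (last′ , first′) ≟-pair (first′ , last′) | (last′ , first′) ≟-pair (last′ , first′)
  ... | yes _ | _     = inj₂ refl
  ... | no _  | yes _ = inj₁ refl
  ... | no _  | no ne = contradiction refl ne

  liftPairs-EndPair : ∀ T → 𝒢′.EndPair T → 𝒢.EndPair (map liftPair T)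
  liftPairs-EndPair T (inj₁ p) = inj₁ (subst (_∈ map liftPair T) liftPair-first-last (∈P.∈-map⁺ liftPair p))
  liftPairs-EndPair T (inj₂ p) with liftPair-last-first
  ... | inj₁ e = inj₂ (subst (_∈ map liftPair T) e (∈P.∈-map⁺ liftPair p))
  ... | inj₂ e = inj₁ (subst (_∈ map liftPair T) e (∈P.∈-map⁺ liftPair p))

  liftPairs-Contains⇒ : ∀ Q → 𝒢.Real Q → ∀ T → 𝒢.Contains (map liftPair T) Q → 𝒢′.Contains T (restrict Q)
  liftPairs-Contains⇒ Q rQ []       []       = []
  liftPairs-Contains⇒ Q rQ (p ∷ T) (q ∷ qs) =
    restrict-≡⇐ Q _ _ (trans (sym (over (proj₁ (liftPair-Over p)))) (trans q (over (proj₂ (liftPair-Over p)))))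
    ∷ liftPairs-Contains⇒ Q rQ T qs
    where open Realizable Q rQ

  liftPairs-Contains⇐ : ∀ Q → 𝒢.Real Q → ∀ T → 𝒢′.Contains T (restrict Q) → 𝒢.Contains (map liftPair T) Q
  liftPairs-Contains⇐ Q rQ []       []       = []
  liftPairs-Contains⇐ Q rQ (p ∷ T) (q ∷ qs) =
    trans (over (proj₁ (liftPair-Over p))) (trans (restrict-≡⇒ Q _ _ q) (sym (over (proj₂ (liftPair-Over p)))))
    ∷ liftPairs-Contains⇐ Q rQ T qs
    where open Realizable Q rQ

  generated-on-copy : ∀ {T Γ Q} → 𝒢′.Generates T Γ → 𝒢.Real Q → 𝒢.Contains (map liftPair T) Q →
                      ∀ t₁ t₂ → Γ t₁ ≡ Γ t₂ → Q (ι t₁) ≡ Q (ι t₂)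
  generated-on-copy {T} {Γ} {Q} gΓ rQ cQ t₁ t₂ p =
    restrict-≡⇒ Q t₁ t₂ (𝒢′.generates-refines gΓ (restrict-Real Q rQ) (liftPairs-Contains⇒ Q rQ T cQ) t₁ t₂ p)

  extend-Generates : ∀ T Γ → 𝒢′.Generates T Γ → 𝒢.Generates (map liftPair T) (extend Γ)
  extend-Generates T Γ gΓ@(rΓ , cΓ , _) =
    extend-Real Γ rΓ ,
    liftPairs-Contains⇐ (extend Γ) (extend-Real Γ rΓ) T (𝒢′.refines-contains T (λ s t → from (restrict-lift s t)) cΓ) ,
    λ Q rQ cQ → lift-refines Q rQ (generated-on-copy gΓ rQ cQ) (at-c Q rQ cQ)
    where
    open Lift Γ (forcedBlock (forcing? Γ))
    at-c : ∀ Q → 𝒢.Real Q → 𝒢.Contains (map liftPair T) Q → ∀ z → forcedBlock (forcing? Γ) ≡ just z → Q c ≡ Q (ι z)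
    at-c Q rQ cQ z forced≡z with forcedBlock-just (forcing? Γ) z forced≡z
    ... | j , cj , sj , refl = to (through-c j cj) (sym (generated-on-copy gΓ rQ cQ _ _ sj))
      where open Realizable Q rQ

  restrict-Generates : ∀ P T′ → 𝒢.Real P → 𝒢′.Contains T′ (restrict P) →
                       (∀ Q′ → 𝒢′.Real Q′ → 𝒢′.Contains T′ Q′ → ∀ t₁ t₂ → P (ι t₁) ≡ P (ι t₂) → Q′ t₁ ≡ Q′ t₂) →
                       𝒢′.Generates T′ (restrict P)
  restrict-Generates P T′ rP cP minimal =
    restrict-Real P rP , cP , λ Q′ rQ′ cQ′ t₁ t₂ p → minimal Q′ rQ′ cQ′ t₁ t₂ (restrict-≡⇒ P t₁ t₂ p)

  -- c is merged into the copy of G′ without being forced to: a generating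
  -- set of P then needs one pair more than one of its restriction.
  FreeMerge : 𝒢.Part → Set
  FreeMerge P = (Σ (Fin n′) λ b → P (ι b) ≡ P c) × ¬ Forcing (P ∘ ι)

  freeMerge? : ∀ P → Dec (FreeMerge P)
  freeMerge? P = FinP.any? (λ b → P (ι b) Fin.≟ P c) ×-dec ¬? (forcing? (P ∘ ι))

  merged-forced : ∀ {P t} → ¬ FreeMerge P → P (ι t) ≡ P c → Forcing (P ∘ ι)
  merged-forced {P} {t} ¬free Pt≡Pc = decidable-stable (forcing? (P ∘ ι)) (λ ¬f → ¬free ((t , Pt≡Pc) , ¬f))

  ¬FreeMerge : ∀ P → 𝒢.Real P → 𝒢.Refines P (extend (restrict P)) → ¬ FreeMerge P
  ¬FreeMerge P rP P⊑ ((b , Pb≡Pc) , ¬forced) with extend-c≡ι⇒ (restrict P) b (sym (P⊑ _ _ Pb≡Pc))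
  ... | j , cj , sj , _ = ¬forced (j , cj , restrict-≡⇒ P _ _ sj)

  generates-via-extend : ∀ P T′ → 𝒢.Real P → 𝒢′.Contains T′ (restrict P) →
                         (∀ Q′ → 𝒢′.Real Q′ → 𝒢′.Contains T′ Q′ → 𝒢.Refines P (extend Q′)) →
                         𝒢′.Generates T′ (restrict P) × ¬ FreeMerge P
  generates-via-extend P T′ rP cP P⊑ =
    restrict-Generates P T′ rP cP (λ Q′ rQ′ cQ′ t₁ t₂ p → to (Lift.lift-ι Q′ _ t₁ t₂) (P⊑ Q′ rQ′ cQ′ _ _ p)) ,
    ¬FreeMerge P rP (P⊑ (restrict P) (restrict-Real P rP) cP)

  record Restricted (T : 𝒢.Pairs) (P : 𝒢.Part) : Set where
    field
      pairs     : 𝒢′.Pairs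
      generates : 𝒢′.Generates pairs (restrict P)
      length-≤  : length pairs ≤ length T
      length-<  : FreeMerge P → suc (length pairs) ≤ length T
      endPair   : 𝒢.EndPair T → 𝒢′.EndPair pairs

  σ-pair : Fin n × Fin n → Fin n′ × Fin n′
  σ-pair (s , t) = σ s , σ t

  σ-pair-first-last : σ-pair (first , last) ≡ (first′ , last′)
  σ-pair-first-last = cong₂ _,_ (σ-Over first-ι) (σ-Over last-ι)

  σ-pair-last-first : σ-pair (last , first) ≡ (last′ , first′)
  σ-pair-last-first = cong₂ _,_ (σ-Over last-ι) (σ-Over first-ι)

  -- The candidate is
  -- T₁′ = σ q ∷ T₀′; when c is freely merged in X one further pair of G′
  -- may be needed, which the saving on X pays for.
  module AddPair {q : Fin n × Fin n} (q₁≢c : proj₁ q ≢ c) (q₂≢c : proj₂ q ≢ c) {T₀ : 𝒢.Pairs} {P X : 𝒢.Part}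
                 (gP : 𝒢.Generates (q ∷ T₀) P) (gX : 𝒢.Generates T₀ X) (RX : Restricted T₀ X) where
    open Restricted RX renaming (pairs to T₀′; generates to gX′; length-≤ to |T₀′|≤; length-< to |T₀′|<;
                                 endPair to endPair₀)
    rP = proj₁ gP
    rX = proj₁ gX
    module P = Realizable P rP
    module X = Realizable X rX

    T₁′ : 𝒢′.Pairs
    T₁′ = σ-pair q ∷ T₀′

    X⊑P : 𝒢.Refines X P
    X⊑P = 𝒢.generates-refines gX rP (All.tail (proj₁ (proj₂ gP)))

    T₁′-in-P : 𝒢′.Contains T₁′ (restrict P)
    T₁′-in-P =
      restrict-≡⇐ P _ _ (trans (sym (P.off-c _ q₁≢c)) (trans (All.head (proj₁ (proj₂ gP))) (P.off-c _ q₂≢c))) ∷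
      𝒢′.refines-contains T₀′ (λ t₁ t₂ → restrict-≡⇐ P t₁ t₂ ∘ X⊑P _ _ ∘ restrict-≡⇒ X t₁ t₂) (proj₁ (proj₂ gX′))

    X⊑ : ∀ {Q′} → 𝒢′.Real Q′ → 𝒢′.Contains T₁′ Q′ → ∀ t₁ t₂ → X (ι t₁) ≡ X (ι t₂) → Q′ t₁ ≡ Q′ t₂
    X⊑ rQ′ cQ′ t₁ t₂ p = 𝒢′.generates-refines gX′ rQ′ (All.tail cQ′) t₁ t₂ (restrict-≡⇐ X t₁ t₂ p)

    P⊑lift : ∀ {Q′} ℓ → 𝒢′.Real Q′ → 𝒢′.Contains T₁′ Q′ → 𝒢.Real (Lift.lift Q′ ℓ) →
             (∀ t → X (ι t) ≡ X c → Lift.lift Q′ ℓ (ι t) ≡ Lift.lift Q′ ℓ c) → 𝒢.Refines P (Lift.lift Q′ ℓ)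
    P⊑lift {Q′} ℓ rQ′ cQ′ rL at-c = 𝒢.generates-refines gP rL (lift-q ∷ 𝒢.refines-contains T₀ X⊑L (proj₁ (proj₂ gX)))
      where
      open Lift Q′ ℓ
      lift-q : lift (proj₁ q) ≡ lift (proj₂ q)
      lift-q = lift-≡⇐ _ _ (trans (label-off-c _ q₁≢c) (trans (cong just (All.head cQ′)) (sym (label-off-c _ q₂≢c))))
      X⊑L : 𝒢.Refines X lift
      X⊑L = refines-criterion X.e≈a rL (λ t₁ t₂ p → from (lift-ι t₁ t₂) (X⊑ rQ′ cQ′ t₁ t₂ p)) at-c

    conclude : ∀ T′ → (∀ {p} → p ∈ T₁′ → p ∈ T′) → 𝒢′.Generates T′ (restrict P) → length T′ ≤ suc (length T₀) →
               (FreeMerge P → suc (length T′) ≤ suc (length T₀)) → Restricted (q ∷ T₀) P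
    conclude T′ T₁′⊆T′ gen len-≤ len-< = record
      { pairs = T′ ; generates = gen ; length-≤ = len-≤ ; length-< = len-< ; endPair = endPair′ }
      where
      endPair′ : 𝒢.EndPair (q ∷ T₀) → 𝒢′.EndPair T′
      endPair′ (inj₁ (here p)) = inj₁ (T₁′⊆T′ (here (trans (sym σ-pair-first-last) (cong σ-pair p))))
      endPair′ (inj₂ (here p)) = inj₂ (T₁′⊆T′ (here (trans (sym σ-pair-last-first) (cong σ-pair p))))
      endPair′ (inj₁ (there p)) with endPair₀ (inj₁ p)
      ... | inj₁ p′ = inj₁ (T₁′⊆T′ (there p′))
      ... | inj₂ p′ = inj₂ (T₁′⊆T′ (there p′))
      endPair′ (inj₂ (there p)) with endPair₀ (inj₂ p)
      ... | inj₁ p′ = inj₁ (T₁′⊆T′ (there p′))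
      ... | inj₂ p′ = inj₂ (T₁′⊆T′ (there p′))

    via-extend : ∀ T′ → (∀ {p} → p ∈ T₁′ → p ∈ T′) → (∀ {Q′} → 𝒢′.Contains T′ Q′ → 𝒢′.Contains T₁′ Q′) →
                 𝒢′.Contains T′ (restrict P) →
                 (∀ Q′ → 𝒢′.Real Q′ → 𝒢′.Contains T′ Q′ → ∀ t → X (ι t) ≡ X c → extend Q′ (ι t) ≡ extend Q′ c) →
                 length T′ ≤ suc (length T₀) → Restricted (q ∷ T₀) P
    via-extend T′ T₁′⊆T′ shrink cP at-c len-≤ with generates-via-extend P T′ rP cP
      (λ Q′ rQ′ cQ′ → P⊑lift _ rQ′ (shrink cQ′) (extend-Real Q′ rQ′) (at-c Q′ rQ′ cQ′))
    ... | gen , ¬free = conclude T′ T₁′⊆T′ gen len-≤ (λ free → contradiction free ¬free)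

    -- If c is not freely merged in X, the candidate T₁′ works: whenever X
    -- merges c with ι t it is forced to, and the forcing persists in the
    -- canonical lift of any Q′ ⊇ T₁′.
    not-free : ¬ FreeMerge X → Restricted (q ∷ T₀) P
    not-free ¬freeX = via-extend T₁′ (λ p → p) (λ c → c) T₁′-in-P at-c (s≤s |T₀′|≤)
      where
      at-c : ∀ Q′ → 𝒢′.Real Q′ → 𝒢′.Contains T₁′ Q′ → ∀ t → X (ι t) ≡ X c → extend Q′ (ι t) ≡ extend Q′ c
      at-c Q′ rQ′ cQ′ t Xt≡Xc with merged-forced {X} ¬freeX Xt≡Xc
      ... | j , cj , sj = sym (trans
          (to (L.through-c j cj) (from (lift-ι a (start′ j)) (X⊑ rQ′ cQ′ _ _ (sym sj))))
          (from (lift-ι (end′ j) t) (X⊑ rQ′ cQ′ _ _ (trans (sym (to (X.through-c j cj) (sym sj))) (sym Xt≡Xc)))))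
        where
        open Lift Q′ (forcedBlock (forcing? Q′)) using (lift-ι)
        module L = Realizable (extend Q′) (extend-Real Q′ rQ′)

    -- If c is freely merged in X (with ι b), compare with the partition Y′
    -- generated by T₁′: either Y′ forces c somewhere, or an x-edge of G′
    -- ends in the block of b (one extra pair each), or the lift of Y′
    -- placing c with b is realizable and T₁′ suffices.
    module Free (freeX : FreeMerge X) {Y′ : 𝒢′.Part} (gY′ : 𝒢′.Generates T₁′ Y′) where
      b : Fin n′
      b = proj₁ (proj₁ freeX)

      Xb≡Xc : X (ι b) ≡ X c
      Xb≡Xc = proj₂ (proj₁ freeX)

      Pb≡Pc : P (ι b) ≡ P c
      Pb≡Pc = X⊑P _ _ Xb≡Xc

      Y′⊑P : ∀ t₁ t₂ → Y′ t₁ ≡ Y′ t₂ → P (ι t₁) ≡ P (ι t₂)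
      Y′⊑P t₁ t₂ p = restrict-≡⇒ P t₁ t₂ (𝒢′.generates-refines gY′ (restrict-Real P rP) T₁′-in-P t₁ t₂ p)

      b~t : ∀ {Q′} → 𝒢′.Real Q′ → 𝒢′.Contains T₁′ Q′ → ∀ t → X (ι t) ≡ X c → Q′ b ≡ Q′ t
      b~t rQ′ cQ′ t Xt≡Xc = X⊑ rQ′ cQ′ b t (trans Xb≡Xc (sym Xt≡Xc))

      EndsAtb : Set
      EndsAtb = Σ (Fin m′) λ j → col′ j ≡ x × Y′ (end′ j) ≡ Y′ b

      endsAtb? : Dec EndsAtb
      endsAtb? = FinP.any? (λ j → (col′ j Fin.≟ x) ×-dec (Y′ (end′ j) Fin.≟ Y′ b))

      forcing : Forcing Y′ → Restricted (q ∷ T₀) P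
      forcing (j , cj , sj) =
        via-extend ((b , end′ j) ∷ T₁′) there All.tail
          (restrict-≡⇐ P _ _ (trans Pb≡Pc (to (P.through-c j cj) (sym (Y′⊑P _ _ sj)))) ∷ T₁′-in-P)
          at-c (s≤s (|T₀′|< freeX))
        where
        at-c : ∀ Q′ → 𝒢′.Real Q′ → 𝒢′.Contains ((b , end′ j) ∷ T₁′) Q′ → ∀ t → X (ι t) ≡ X c → extend Q′ (ι t) ≡ extend Q′ c
        at-c Q′ rQ′ (b~j ∷ cQ′) t Xt≡Xc = sym (trans
          (to (L.through-c j cj) (from (lift-ι a (start′ j)) (sym (𝒢′.generates-refines gY′ rQ′ cQ′ _ _ sj))))
          (from (lift-ι (end′ j) t) (trans (sym b~j) (b~t rQ′ cQ′ t Xt≡Xc))))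
          where
          open Lift Q′ (forcedBlock (forcing? Q′)) using (lift-ι)
          module L = Realizable (extend Q′) (extend-Real Q′ rQ′)

      endsAtb : EndsAtb → Restricted (q ∷ T₀) P
      endsAtb (j , cj , ej) =
        via-extend ((a , start′ j) ∷ T₁′) there All.tail
          (restrict-≡⇐ P _ _ (from (P.through-c j cj) (trans (sym Pb≡Pc) (sym (Y′⊑P _ _ ej)))) ∷ T₁′-in-P)
          at-c (s≤s (|T₀′|< freeX))
        where
        at-c : ∀ Q′ → 𝒢′.Real Q′ → 𝒢′.Contains ((a , start′ j) ∷ T₁′) Q′ → ∀ t → X (ι t) ≡ X c → extend Q′ (ι t) ≡ extend Q′ c
        at-c Q′ rQ′ (a~j ∷ cQ′) t Xt≡Xc = sym (trans
          (to (L.through-c j cj) (from (lift-ι a (start′ j)) a~j))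
          (from (lift-ι (end′ j) t) (trans (𝒢′.generates-refines gY′ rQ′ cQ′ _ _ ej) (b~t rQ′ cQ′ t Xt≡Xc))))
          where
          open Lift Q′ (forcedBlock (forcing? Q′)) using (lift-ι)
          module L = Realizable (extend Q′) (extend-Real Q′ rQ′)

      neither : ¬ Forcing Y′ → ¬ EndsAtb → Restricted (q ∷ T₀) P
      neither ¬forcing ¬endsAtb = conclude T₁′ (λ p → p) gen (s≤s |T₀′|≤) (λ _ → s≤s (|T₀′|< freeX))
        where
        rY′ = proj₁ gY′
        cY′ = proj₁ (proj₂ gY′)
        open Lift Y′ (just b)
        valid : Valid
        valid j cj = mk⇔ (λ p → contradiction (j , cj , p) ¬forcing)
                         (λ p → contradiction (j , cj , sym (just-injective p)) ¬endsAtb)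
        P⊑L : 𝒢.Refines P lift
        P⊑L = P⊑lift (just b) rY′ cY′ (lift-Real rY′ valid)
                     (λ t Xt≡Xc → sym (lift-c≡ι⇐ t b refl (b~t rY′ cY′ t Xt≡Xc)))
        gen : 𝒢′.Generates T₁′ (restrict P)
        gen = restrict-Generates P T₁′ rP T₁′-in-P
                (λ Q′ rQ′ cQ′ t₁ t₂ p → 𝒢′.generates-refines gY′ rQ′ cQ′ t₁ t₂ (to (lift-ι t₁ t₂) (P⊑L _ _ p)))

      restricted : Restricted (q ∷ T₀) P
      restricted with forcing? Y′ | endsAtb?
      ... | yes f  | _      = forcing f
      ... | no ¬f  | yes e  = endsAtb e
      ... | no ¬f  | no ¬e  = neither ¬f ¬e

    restricted : ¬ ¬ Restricted (q ∷ T₀) P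
    restricted = ¬¬-excluded-middle >>= λ
      { (no ¬freeX) → pure (not-free ¬freeX)
      ; (yes freeX) → 𝒢′.Closure.closure T₁′ >>= λ (Y′ , gY′) → pure (Free.restricted freeX gY′) }

  touching-c : ∀ q → proj₁ q ≡ c ⊎ proj₂ q ≡ c →
               Σ (Fin n) λ s → ∀ (Q : 𝒢.Part) → (Q (proj₁ q) ≡ Q (proj₂ q)) ⇔ (Q c ≡ Q s)
  touching-c (_ , s) (inj₁ refl) = s , λ Q → mk⇔ (λ p → p) (λ p → p)
  touching-c (s , _) (inj₂ refl) = s , λ Q → mk⇔ sym sym

  EndPair-drop : ∀ {q} T₀ → proj₁ q ≡ c ⊎ proj₂ q ≡ c → 𝒢.EndPair (q ∷ T₀) → 𝒢.EndPair T₀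
  EndPair-drop T₀ _             (inj₁ (there p))    = inj₁ p
  EndPair-drop T₀ _             (inj₂ (there p))    = inj₂ p
  EndPair-drop T₀ (inj₁ q₁≡c)   (inj₁ (here refl))  = contradiction q₁≡c first≢c
  EndPair-drop T₀ (inj₂ q₂≡c)   (inj₁ (here refl))  = contradiction q₂≡c last≢c
  EndPair-drop T₀ (inj₁ q₁≡c)   (inj₂ (here refl))  = contradiction q₁≡c last≢c
  EndPair-drop T₀ (inj₂ q₂≡c)   (inj₂ (here refl))  = contradiction q₂≡c first≢c

  EndPair-there : ∀ {p} T₀ → 𝒢.EndPair T₀ → 𝒢.EndPair (p ∷ T₀)
  EndPair-there T₀ (inj₁ e) = inj₁ (there e)
  EndPair-there T₀ (inj₂ e) = inj₂ (there e)

  -- Using X, the partition generated by T₀, q can be replaced by a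
  -- pair avoiding c, unless c is isolated in X and no x-edge of G′ ends in
  -- the block of s; then the restricted generators of X already suffice.
  module AddPairAtC {q : Fin n × Fin n} {s : Fin n} (s≢c : s ≢ c)
                    (q⇔c~s : ∀ (Q : 𝒢.Part) → (Q (proj₁ q) ≡ Q (proj₂ q)) ⇔ (Q c ≡ Q s))
                    {T₀ : 𝒢.Pairs} (drop : 𝒢.EndPair (q ∷ T₀) → 𝒢.EndPair T₀) {P X : 𝒢.Part}
                    (gP : 𝒢.Generates (q ∷ T₀) P) (gX : 𝒢.Generates T₀ X) (RX : Restricted T₀ X) where
    open Restricted RX using () renaming (pairs to T₀′; generates to gX′; length-≤ to |T₀′|≤)
    rP = proj₁ gP
    rX = proj₁ gX
    module X = Realizable X rX

    X⊑ : ∀ {Q} → 𝒢.Real Q → 𝒢.Contains T₀ Q → 𝒢.Refines X Q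
    X⊑ = 𝒢.generates-refines gX

    replace : ∀ q̃ → proj₁ q̃ ≢ c → proj₂ q̃ ≢ c →
              (∀ Q → 𝒢.Real Q → 𝒢.Contains T₀ Q → (Q c ≡ Q s) ⇔ (Q (proj₁ q̃) ≡ Q (proj₂ q̃))) →
              ¬ ¬ Restricted (q ∷ T₀) P
    replace q̃ q̃₁≢c q̃₂≢c c~s⇔q̃ = do
      R ← AddPair.restricted q̃₁≢c q̃₂≢c (𝒢.generates-replace q⇔q̃ gP) gX RX
      let open Restricted R
      pure (record { pairs = pairs ; generates = generates ; length-≤ = length-≤ ; length-< = length-<
                   ; endPair = endPair ∘ EndPair-there T₀ ∘ drop })
      where
      q⇔q̃ : ∀ Q → 𝒢.Real Q → 𝒢.Contains T₀ Q → (Q (proj₁ q) ≡ Q (proj₂ q)) ⇔ (Q (proj₁ q̃) ≡ Q (proj₂ q̃))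
      q⇔q̃ Q rQ cQ = mk⇔ (to (c~s⇔q̃ Q rQ cQ) ∘ to (q⇔c~s Q)) (from (q⇔c~s Q) ∘ from (c~s⇔q̃ Q rQ cQ))

    merged : Σ (Fin n′) (λ b → X (ι b) ≡ X c) → ¬ ¬ Restricted (q ∷ T₀) P
    merged (b , Xb≡Xc) = replace (ι b , s) (ι≢c b) s≢c λ Q rQ cQ →
      let Qb≡Qc = X⊑ rQ cQ _ _ Xb≡Xc in
      mk⇔ (trans Qb≡Qc) (trans (sym Qb≡Qc))

    endsAts : Σ (Fin m′) (λ j → col′ j ≡ x × X (ι (end′ j)) ≡ X s) → ¬ ¬ Restricted (q ∷ T₀) P
    endsAts (j , cj , ej) = replace (ι a , ι (start′ j)) (ι≢c a) (ι≢c _) λ Q rQ cQ →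
      let open Realizable Q rQ using (through-c)
          Qj≡Qs = X⊑ rQ cQ _ _ ej in
      mk⇔ (λ p → from (through-c j cj) (trans p (sym Qj≡Qs))) (λ p → trans (to (through-c j cj) p) Qj≡Qs)

    -- otherwise the restricted generators of X generate the restriction of
    -- P: the lift of the restriction of X placing c with s is realizable
    isolated : ¬ Σ (Fin n′) (λ b → X (ι b) ≡ X c) → ¬ Σ (Fin m′) (λ j → col′ j ≡ x × X (ι (end′ j)) ≡ X s) →
               Restricted (q ∷ T₀) P
    isolated ¬merged ¬endsAts = record
      { pairs = T₀′ ; generates = gen ; length-≤ = ℕP.m≤n⇒m≤1+n |T₀′|≤ ; length-< = λ _ → s≤s |T₀′|≤
      ; endPair = endPair ∘ drop }
      where
      open Restricted RX using (endPair)
      open Lift (restrict X) (just (σ s))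
      valid : Valid
      valid j cj = mk⇔
        (λ p → contradiction (end′ j , sym (to (X.through-c j cj) (sym (restrict-≡⇒ X _ _ p)))) ¬merged)
        (λ p → contradiction (j , cj , trans (sym (restrict-≡⇒ X _ _ (just-injective p))) (sym (X.off-c s s≢c))) ¬endsAts)
      rL : 𝒢.Real lift
      rL = lift-Real (restrict-Real X rX) valid
      X⊑L : 𝒢.Refines X lift
      X⊑L = refines-criterion X.e≈a rL (λ t₁ t₂ p → from (lift-ι t₁ t₂) (restrict-≡⇐ X t₁ t₂ p))
                              (λ t Xt≡Xc → contradiction (t , Xt≡Xc) ¬merged)
      Lc≡Ls : lift c ≡ lift s
      Lc≡Ls = trans (lift-c≡ι⇐ (σ s) (σ s) refl refl) (sym (Realizable.off-c lift rL s s≢c))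
      P⊑L : 𝒢.Refines P lift
      P⊑L = 𝒢.generates-refines gP rL (from (q⇔c~s lift) Lc≡Ls ∷ 𝒢.refines-contains T₀ X⊑L (proj₁ (proj₂ gX)))
      X⊑P : 𝒢.Refines X P
      X⊑P = 𝒢.generates-refines gX rP (All.tail (proj₁ (proj₂ gP)))
      gen : 𝒢′.Generates T₀′ (restrict P)
      gen = restrict-Generates P T₀′ rP
              (𝒢′.refines-contains T₀′ (λ t₁ t₂ → restrict-≡⇐ P t₁ t₂ ∘ X⊑P _ _ ∘ restrict-≡⇒ X t₁ t₂) (proj₁ (proj₂ gX′)))
              (λ Q′ rQ′ cQ′ t₁ t₂ p → 𝒢′.generates-refines gX′ rQ′ cQ′ t₁ t₂ (to (lift-ι t₁ t₂) (P⊑L _ _ p)))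

    restricted : ¬ ¬ Restricted (q ∷ T₀) P
    restricted with FinP.any? (λ b → X (ι b) Fin.≟ X c)
                  | FinP.any? (λ j → (col′ j Fin.≟ x) ×-dec (X (ι (end′ j)) Fin.≟ X s))
    ... | yes m  | _      = merged m
    ... | no ¬m  | yes e  = endsAts e
    ... | no ¬m  | no ¬e  = pure (isolated ¬m ¬e)

  Restricted-weaken : ∀ {q T₀ P} → (𝒢.EndPair (q ∷ T₀) → 𝒢.EndPair T₀) → Restricted T₀ P → Restricted (q ∷ T₀) P
  Restricted-weaken drop R = record
    { pairs = pairs ; generates = generates ; length-≤ = ℕP.m≤n⇒m≤1+n length-≤
    ; length-< = ℕP.m≤n⇒m≤1+n ∘ length-< ; endPair = endPair ∘ drop }
    where open Restricted R

  -- Every generating set of a partition of G yields restricted generators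
  -- (classically), by induction on the generating set via the partition
  -- generated by its tail.
  restrictGenerators : ∀ T P → 𝒢.Generates T P → ¬ ¬ Restricted T P
  restrictGenerators [] P gP with generates-via-extend P [] (proj₁ gP) []
                                    (λ Q′ rQ′ _ → 𝒢.generates-refines gP (extend-Real Q′ rQ′) [])
  ... | gen , ¬free = pure (record { pairs = [] ; generates = gen ; length-≤ = z≤n
                                   ; length-< = λ free → contradiction free ¬free
                                   ; endPair = λ { (inj₁ ()) ; (inj₂ ()) } })
  restrictGenerators (q ∷ T₀) P gP = do
    (X , gX) ← 𝒢.Closure.closure T₀
    RX ← restrictGenerators T₀ X gX
    step gX RX
    where
    atC : ∀ {X} → proj₁ q ≡ c ⊎ proj₂ q ≡ c → 𝒢.Generates T₀ X → Restricted T₀ X → ¬ ¬ Restricted (q ∷ T₀) P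
    atC touch gX RX with touching-c q touch
    ... | s , q⇔c~s with s Fin.≟ c
    ... | no s≢c  = AddPairAtC.restricted s≢c q⇔c~s (EndPair-drop T₀ touch) gP gX RX
    ... | yes refl = do
      R ← restrictGenerators T₀ P (rP , All.tail cP , λ Q rQ cQ → minimal Q rQ (from (q⇔c~s Q) refl ∷ cQ))
      pure (Restricted-weaken (EndPair-drop T₀ touch) R)
      where
      rP = proj₁ gP
      cP = proj₁ (proj₂ gP)
      minimal = proj₂ (proj₂ gP)

    step : ∀ {X} → 𝒢.Generates T₀ X → Restricted T₀ X → ¬ ¬ Restricted (q ∷ T₀) P
    step gX RX with proj₁ q Fin.≟ c | proj₂ q Fin.≟ c
    ... | no q₁≢c  | no q₂≢c  = AddPair.restricted q₁≢c q₂≢c gP gX RX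
    ... | yes q₁≡c | _        = atC (inj₁ q₁≡c) gX RX
    ... | no _     | yes q₂≡c = atC (inj₂ q₂≡c) gX RX

  -- Restriction preserves type B: if the restriction of P had a minimum
  -- generating set S′ containing the end pair, its lift (plus the pair
  -- (c , ι b) when c is freely merged with ι b) would be one for P.
  restrict-TypeB : ∀ P → 𝒢.InQ P → 𝒢.TypeB P → 𝒢′.TypeB (restrict P)
  restrict-TypeB P (rP , _) typeB (S′ , gS′ , minS′ , endS′) = typeB typeA
    where
    open Realizable P rP using (e≈a; through-c)
    S = map liftPair S′

    |S|≡ : length S ≡ length S′
    |S|≡ = ListP.length-map liftPair S′

    on-copy : ∀ {Q} → 𝒢.Real Q → 𝒢.Contains S Q → ∀ t₁ t₂ → P (ι t₁) ≡ P (ι t₂) → Q (ι t₁) ≡ Q (ι t₂)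
    on-copy rQ cQ t₁ t₂ p = generated-on-copy gS′ rQ cQ t₁ t₂ (restrict-≡⇐ P t₁ t₂ p)

    S-in-P : 𝒢.Contains S P
    S-in-P = liftPairs-Contains⇐ P rP S′ (proj₁ (proj₂ gS′))

    lower-bound : ∀ {ℓ T} → 𝒢.Generates T P → (Restricted T P → ℓ ≤ length T) → ℓ ≤ length T
    lower-bound {ℓ} {T} gT bound = decidable-stable (ℓ ℕP.≤? length T) (restrictGenerators T P gT >>= pure ∘ bound)

    S′-minimal : ∀ {T} (R : Restricted T P) → length S′ ≤ length (Restricted.pairs R)
    S′-minimal R = minS′ _ (Restricted.generates R)

    typeA : 𝒢.TypeA P
    typeA with freeMerge? P
    ... | no ¬free = S , (rP , S-in-P , λ Q rQ cQ → refines-criterion e≈a rQ (on-copy rQ cQ) (at-c rQ cQ)) ,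
                     (λ T gT → lower-bound gT λ R →
                        ℕP.≤-trans (ℕP.≤-reflexive |S|≡) (ℕP.≤-trans (S′-minimal R) (Restricted.length-≤ R))) ,
                     liftPairs-EndPair S′ endS′
      where
      -- c is only merged with the copy where forced
      at-c : ∀ {Q} → 𝒢.Real Q → 𝒢.Contains S Q → ∀ t → P (ι t) ≡ P c → Q (ι t) ≡ Q c
      at-c {Q} rQ cQ t Pt≡Pc with merged-forced {P} ¬free Pt≡Pc
      ... | j , cj , sj = sym (trans
        (to (Realizable.through-c Q rQ j cj) (on-copy rQ cQ _ _ (sym sj)))
        (on-copy rQ cQ _ _ (trans (sym (to (through-c j cj) (sym sj))) (sym Pt≡Pc))))
    ... | yes free@((b , Pb≡Pc) , _) =
      (c , ι b) ∷ S ,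
      (rP , sym Pb≡Pc ∷ S-in-P ,
       λ { Q rQ (c~b ∷ cQ) → refines-criterion e≈a rQ (on-copy rQ cQ)
                               (λ t Pt≡Pc → trans (on-copy rQ cQ t b (trans Pt≡Pc (sym Pb≡Pc))) (sym c~b)) }) ,
      (λ T gT → lower-bound gT λ R →
         ℕP.≤-trans (s≤s (ℕP.≤-trans (ℕP.≤-reflexive |S|≡) (S′-minimal R))) (Restricted.length-< R free)) ,
      EndPair-there S (liftPairs-EndPair S′ endS′)

  -- The canonical lift preserves type B: a minimum generating set of the
  -- lift containing the end pair would restrict to one of Γ.
  extend-TypeB : ∀ Γ → 𝒢′.InQ Γ → 𝒢′.TypeB Γ → 𝒢.TypeB (extend Γ)
  extend-TypeB Γ _ typeB (S , gS , minS , endS) = restrictGenerators S (extend Γ) gS λ R →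
    let open Restricted R in
    typeB (pairs ,
           𝒢′.same-Generates restrict-lift generates ,
           (λ T gT → ℕP.≤-trans length-≤ (ℕP.≤-trans (minS _ (extend-Generates T Γ gT))
                                                   (ℕP.≤-reflexive (ListP.length-map liftPair T)))) ,
           endPair endS)
    where open Lift Γ (forcedBlock (forcing? Γ)) using (restrict-lift)

  comparison : Comparison 𝒢.setting 𝒢′.setting
  comparison = record
    { restrict       = restrict
    ; lift           = extend
    ; restrict-InQ   = restrict-InQ
    ; restrict-TypeB = restrict-TypeB
    ; restrict-chi   = χ-restrict
    ; lift-InQ       = extend-InQ
    ; lift-TypeB     = extend-TypeB
    ; lift-chi       = χ-extend
    }

  β-cancel : ∀ b → 𝒢.IsBeta b ⇔ 𝒢′.IsBeta b
  β-cancel = β-transfer comparison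

open Defs

-- Step j joins s_j and s_{j+1}; it is oriented
-- forwards when its sign agrees with a reference sign o and backwards
-- otherwise.  (Realizability does not depend on o; the choice o = sign of
-- the first letter of a cancelling pair makes both cancelled edges end at
-- the middle symbol.)
orient : ∀ {A : Set} → Bool → Bool → A → A → A
orient true  true  s t = s
orient true  false s t = t
orient false true  s t = t
orient false false s t = s

orient-map : ∀ {A B : Set} (f : A → B) o g s t → f (orient o g s t) ≡ orient o g (f s) (f t)
orient-map f true  true  s t = refl
orient-map f true  false s t = refl
orient-map f false true  s t = refl
orient-map f false false s t = refl

orient-same : ∀ {A : Set} o (s t : A) → orient o o s t ≡ s
orient-same true  s t = refl
orient-same false s t = refl

orient-not : ∀ {A : Set} o (s t : A) → orient o (not o) s t ≡ t
orient-not true  s t = refl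
orient-not false s t = refl

wordGraph : ∀ {k} → Bool → Word k → Graph k
wordGraph o w = record
  { n = suc (length w) ; m = length w ; col = colour w
  ; start = λ j → orient o (sign w j) (src w j) (tgt w j)
  ; end   = λ j → orient o (sign w j) (tgt w j) (src w j)
  ; first = s₀ w ; last = sₘ w }

module WordGraph {k : ℕ} (o : Bool) (w : Word k) where
  module 𝒢 = GraphTheory (wordGraph o w)

  private
    graph⇒word : ∀ o′ {A : Set} (P : Sym w → A) g g′ s t s′ t′ →
      ((P (orient o′ g s t) ≡ P (orient o′ g′ s′ t′)) ⇔ (P (orient o′ g t s) ≡ P (orient o′ g′ t′ s′))) →
      (g ≡ g′ → (P s ≡ P s′) ⇔ (P t ≡ P t′)) × (g ≡ not g′ → (P s ≡ P t′) ⇔ (P t ≡ P s′))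
    graph⇒word true  P true  true  s t s′ t′ f = (λ _ → f) , λ ()
    graph⇒word true  P false false s t s′ t′ f = (λ _ → ⇔.sym f) , λ ()
    graph⇒word true  P true  false s t s′ t′ f = (λ ()) , λ _ → f
    graph⇒word true  P false true  s t s′ t′ f = (λ ()) , λ _ → ⇔.sym f
    graph⇒word false P true  true  s t s′ t′ f = (λ _ → ⇔.sym f) , λ ()
    graph⇒word false P false false s t s′ t′ f = (λ _ → f) , λ ()
    graph⇒word false P true  false s t s′ t′ f = (λ ()) , λ _ → ⇔.sym f
    graph⇒word false P false true  s t s′ t′ f = (λ ()) , λ _ → f

    word⇒graph : ∀ o′ {A : Set} (P : Sym w → A) g g′ s t s′ t′ →
      (g ≡ g′ → (P s ≡ P s′) ⇔ (P t ≡ P t′)) → (g ≡ not g′ → (P s ≡ P t′) ⇔ (P t ≡ P s′)) →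
      (P (orient o′ g s t) ≡ P (orient o′ g′ s′ t′)) ⇔ (P (orient o′ g t s) ≡ P (orient o′ g′ t′ s′))
    word⇒graph true  P true  true  s t s′ t′ f _ = f refl
    word⇒graph true  P false false s t s′ t′ f _ = ⇔.sym (f refl)
    word⇒graph true  P true  false s t s′ t′ _ f = f refl
    word⇒graph true  P false true  s t s′ t′ _ f = ⇔.sym (f refl)
    word⇒graph false P true  true  s t s′ t′ f _ = ⇔.sym (f refl)
    word⇒graph false P false false s t s′ t′ f _ = f refl
    word⇒graph false P true  false s t s′ t′ _ f = ⇔.sym (f refl)
    word⇒graph false P false true  s t s′ t′ _ f = f refl

  realizable⇔ : ∀ P → Realizable w P ⇔ 𝒢.Real P
  realizable⇔ P = mk⇔
    (λ r h l c → word⇒graph o P (sign w h) (sign w l) _ _ _ _ (proj₁ (r h l c)) (proj₂ (r h l c)))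
    (λ r h l c → graph⇒word o P (sign w h) (sign w l) _ _ _ _ (r h l c))

  private
    swapIf : Bool → Triple k (suc (length w)) → Triple k (suc (length w))
    swapIf true  t           = t
    swapIf false (i , s , t) = i , t , s

    swapIf-injective : ∀ g {t u} → swapIf g t ≡ swapIf g u → t ≡ u
    swapIf-injective true  e    = e
    swapIf-injective false refl = refl

    orientedEdge : ∀ o′ (P : Sym w → Sym w) j →
                   (colour w j , P (orient o′ (sign w j) (src w j) (tgt w j)) , P (orient o′ (sign w j) (tgt w j) (src w j)))
                   ≡ swapIf o′ (edge w P j)
    orientedEdge o′ P j with o′ | sign w j
    ... | true  | true  = refl
    ... | true  | false = refl
    ... | false | true  = refl
    ... | false | false = refl

    graphEdge : ∀ P j → 𝒢.edge P j ≡ swapIf o (edge w P j)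
    graphEdge = orientedEdge o

  #edges≡ : ∀ P → numEdges w P ≡ 𝒢.#edges P
  #edges≡ P = distinct-map-kernel _ _ (allFin (length w)) (edge w P) (𝒢.edge P) λ {i} {j} _ _ → mk⇔
    (λ e → trans (graphEdge P i) (trans (cong (swapIf o) e) (sym (graphEdge P j))))
    (λ e → swapIf-injective o (trans (sym (graphEdge P i)) (trans e (graphEdge P j))))

  private
    module E = EquivalentSettings {first = s₀ w} {last = sₘ w} {χ₁ = χ w} {χ₂ = 𝒢.χ} realizable⇔
                                  (λ P _ → cong (λ e → euler e (numVertices w P)) (#edges≡ P))

  -- (split on b so that the β of Defs unfolds to that of the setting)
  β-wordGraph : ∀ b → IsBeta w b ⇔ 𝒢.IsBeta b
  β-wordGraph nothing  = β-transfer E.comparison nothing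
  β-wordGraph (just c) = β-transfer E.comparison (just c)

-- One cancellation step between words, realised as a cancellation of
-- their graphs for a reference sign o; the embedding fixes s₀, so that
-- steps can be performed behind a common prefix.
record CancelStep {k : ℕ} (w w′ : Word k) : Set where
  field
    o            : Bool
    cancellation : Cancellation (wordGraph o w) (wordGraph o w′)
    ι-s₀         : Cancellation.ι cancellation Fin.zero ≡ Fin.zero

β-step : ∀ {k} {w w′ : Word k} → CancelStep w w′ → ∀ b → IsBeta w b ⇔ IsBeta w′ b
β-step {w = w} {w′} S b =
  ⇔.trans (WordGraph.β-wordGraph o w b)
          (⇔.trans (CancellationTheory.β-cancel _ _ cancellation b) (⇔.sym (WordGraph.β-wordGraph o w′ b)))
  where open CancelStep S

inverse-letters : ∀ {k} (x y : Letter k) → isInverse x y ≡ true → proj₁ x ≡ proj₁ y × proj₂ y ≡ not (proj₂ x)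
inverse-letters (i , α) (j , β) e with i Fin.≟ j | α BoolP.≟ β
... | yes i≡j | no α≢β = i≡j , ¬-not (α≢β ∘ sym)

-- Cancelling the first two letters x y of x y v.  With o the sign of x,
-- both steps end at s₁ = c, while s₂ = e is merged with s₀ = ι a.
module CancelHead {k : ℕ} (x y : Letter k) (v : Word k) (inv : isInverse x y ≡ true) where
  private
    o : Bool
    o = proj₂ x

    module Gv = Graph (wordGraph o v)

    ι : Sym v → Sym (x ∷ y ∷ v)
    ι Fin.zero    = Fin.zero
    ι (Fin.suc t) = Fin.suc (Fin.suc (Fin.suc t))

    σ : Sym (x ∷ y ∷ v) → Sym v
    σ Fin.zero                          = Fin.zero
    σ (Fin.suc Fin.zero)                = Fin.zero
    σ (Fin.suc (Fin.suc Fin.zero))      = Fin.zero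
    σ (Fin.suc (Fin.suc (Fin.suc t)))   = Fin.suc t

    shift : Sym v → Sym (x ∷ y ∷ v)
    shift t = Fin.suc (Fin.suc t)

    shift-over : ∀ {s} t → s ≡ shift t → s ≡ ι t ⊎ (s ≡ Fin.suc (Fin.suc Fin.zero) × t ≡ Fin.zero)
    shift-over Fin.zero    refl = inj₂ (refl , refl)
    shift-over (Fin.suc t) refl = inj₁ refl

    x⁻¹ = inverse-letters x y inv

  step : CancelStep (x ∷ y ∷ v) v
  step = record { o = o ; ι-s₀ = refl ; cancellation = record
    { ι = ι ; σ = σ ; a = Fin.zero ; c = Fin.suc Fin.zero ; e = Fin.suc (Fin.suc Fin.zero)
    ; ιₑ = λ j → Fin.suc (Fin.suc j) ; h₁ = Fin.zero ; h₂ = Fin.suc Fin.zero ; x = proj₁ x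
    ; σ∘ι = λ { Fin.zero → refl ; (Fin.suc t) → refl }
    ; σ-e = refl
    ; ι≢c = λ { Fin.zero () ; (Fin.suc t) () }
    ; e≢c = λ ()
    ; symbols = λ { Fin.zero → inj₂ (inj₂ refl) ; (Fin.suc Fin.zero) → inj₁ refl
                  ; (Fin.suc (Fin.suc Fin.zero)) → inj₂ (inj₁ refl) ; (Fin.suc (Fin.suc (Fin.suc t))) → inj₂ (inj₂ refl) }
    ; edges = λ { Fin.zero → inj₁ refl ; (Fin.suc Fin.zero) → inj₂ (inj₁ refl)
                ; (Fin.suc (Fin.suc j)) → inj₂ (inj₂ (j , refl)) }
    ; col-h₁ = refl
    ; col-h₂ = sym (proj₁ x⁻¹)
    ; col-ιₑ = λ j → refl
    ; start-h₁ = orient-same o Fin.zero (Fin.suc Fin.zero)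
    ; end-h₁ = orient-same o (Fin.suc Fin.zero) Fin.zero
    ; start-h₂ = trans (cong (λ g → orient o g (Fin.suc Fin.zero) (Fin.suc (Fin.suc Fin.zero))) (proj₂ x⁻¹))
                       (orient-not o _ _)
    ; end-h₂ = trans (cong (λ g → orient o g (Fin.suc (Fin.suc Fin.zero)) (Fin.suc Fin.zero)) (proj₂ x⁻¹))
                     (orient-not o _ _)
    ; start-ιₑ = λ j → shift-over (Gv.start j) (sym (orient-map shift o (sign v j) (src v j) (tgt v j)))
    ; end-ιₑ = λ j → shift-over (Gv.end j) (sym (orient-map shift o (sign v j) (tgt v j) (src v j)))
    ; first-ι = inj₁ refl
    ; last-ι = shift-over (fromℕ (length v)) refl
    } }

-- A cancellation step in w is one in z w: the first step of z w is
-- copied, everything else is shifted by one.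
module CancelUnder {k : ℕ} (z : Letter k) {w w′ : Word k} (S : CancelStep w w′) where
  open CancelStep S
  open Cancellation cancellation
  private
    ι⁺ : Sym (z ∷ w′) → Sym (z ∷ w)
    ι⁺ Fin.zero    = Fin.zero
    ι⁺ (Fin.suc t) = Fin.suc (ι t)

    σ⁺ : Sym (z ∷ w) → Sym (z ∷ w′)
    σ⁺ Fin.zero    = Fin.zero
    σ⁺ (Fin.suc s) = Fin.suc (σ s)

    ιₑ⁺ : Step (z ∷ w′) → Step (z ∷ w)
    ιₑ⁺ Fin.zero    = Fin.zero
    ιₑ⁺ (Fin.suc j) = Fin.suc (ιₑ j)

    suc-injective : ∀ {N} {s t : Fin N} → Fin.suc s ≡ Fin.suc t → s ≡ t
    suc-injective refl = refl

    over⁺ : ∀ {s t s⁺ t⁺} → s⁺ ≡ Fin.suc s → t⁺ ≡ Fin.suc t → s ≡ ι t ⊎ (s ≡ e × t ≡ a) →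
            s⁺ ≡ ι⁺ t⁺ ⊎ (s⁺ ≡ Fin.suc e × t⁺ ≡ Fin.suc a)
    over⁺ refl refl (inj₁ p)       = inj₁ (cong Fin.suc p)
    over⁺ refl refl (inj₂ (p , q)) = inj₂ (cong Fin.suc p , cong Fin.suc q)

    start-suc : ∀ (u : Word k) j → Graph.start (wordGraph o (z ∷ u)) (Fin.suc j) ≡ Fin.suc (Graph.start (wordGraph o u) j)
    start-suc u j = sym (orient-map Fin.suc o (sign u j) (src u j) (tgt u j))

    end-suc : ∀ (u : Word k) j → Graph.end (wordGraph o (z ∷ u)) (Fin.suc j) ≡ Fin.suc (Graph.end (wordGraph o u) j)
    end-suc u j = sym (orient-map Fin.suc o (sign u j) (tgt u j) (src u j))

    -- the first step joins s₀ and s₁, which ι⁺ fixes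
    ι⁺-s₁ : ι⁺ (Fin.suc Fin.zero) ≡ Fin.suc Fin.zero
    ι⁺-s₁ = cong Fin.suc ι-s₀

    ι⁺-start₀ : ι⁺ (orient o (proj₂ z) Fin.zero (Fin.suc Fin.zero)) ≡ orient o (proj₂ z) Fin.zero (Fin.suc Fin.zero)
    ι⁺-start₀ = trans (orient-map ι⁺ o (proj₂ z) _ _) (cong (orient o (proj₂ z) Fin.zero) ι⁺-s₁)

    ι⁺-end₀ : ι⁺ (orient o (proj₂ z) (Fin.suc Fin.zero) Fin.zero) ≡ orient o (proj₂ z) (Fin.suc Fin.zero) Fin.zero
    ι⁺-end₀ = trans (orient-map ι⁺ o (proj₂ z) _ _) (cong (λ s → orient o (proj₂ z) s Fin.zero) ι⁺-s₁)

  step : CancelStep (z ∷ w) (z ∷ w′)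
  step = record { o = o ; ι-s₀ = refl ; cancellation = record
    { ι = ι⁺ ; σ = σ⁺ ; a = Fin.suc a ; c = Fin.suc c ; e = Fin.suc e ; ιₑ = ιₑ⁺
    ; h₁ = Fin.suc h₁ ; h₂ = Fin.suc h₂ ; x = x
    ; σ∘ι = λ { Fin.zero → refl ; (Fin.suc t) → cong Fin.suc (σ∘ι t) }
    ; σ-e = cong Fin.suc σ-e
    ; ι≢c = λ { Fin.zero () ; (Fin.suc t) p → ι≢c t (suc-injective p) }
    ; e≢c = e≢c ∘ suc-injective
    ; symbols = λ { Fin.zero → inj₂ (inj₂ refl)
                  ; (Fin.suc s) → Sum.map (cong Fin.suc) (Sum.map (cong Fin.suc) (cong Fin.suc)) (symbols s) }
    ; edges = λ { Fin.zero → inj₂ (inj₂ (Fin.zero , refl))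
                ; (Fin.suc h) → Sum.map (cong Fin.suc) (Sum.map (cong Fin.suc) (λ (j , p) → Fin.suc j , cong Fin.suc p))
                                        (edges h) }
    ; col-h₁ = col-h₁
    ; col-h₂ = col-h₂
    ; col-ιₑ = λ { Fin.zero → refl ; (Fin.suc j) → col-ιₑ j }
    ; start-h₁ = trans (start-suc w h₁) (cong Fin.suc start-h₁)
    ; end-h₁ = trans (end-suc w h₁) (cong Fin.suc end-h₁)
    ; start-h₂ = trans (start-suc w h₂) (cong Fin.suc start-h₂)
    ; end-h₂ = trans (end-suc w h₂) (cong Fin.suc end-h₂)
    ; start-ιₑ = λ { Fin.zero → inj₁ (sym ι⁺-start₀)
                   ; (Fin.suc j) → over⁺ (start-suc w (ιₑ j)) (start-suc w′ j) (start-ιₑ j) }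
    ; end-ιₑ = λ { Fin.zero → inj₁ (sym ι⁺-end₀)
                 ; (Fin.suc j) → over⁺ (end-suc w (ιₑ j)) (end-suc w′ j) (end-ιₑ j) }
    ; first-ι = inj₁ refl
    ; last-ι = over⁺ refl refl last-ι
    } }

-- Every word reduces to its reduced form by cancellation steps: pushing
-- a letter cancels at most one pair, and reduction pushes the letters one
-- by one behind the already reduced tail.
push-steps : ∀ {k} (z : Letter k) (u : Word k) → Star CancelStep (z ∷ u) (push z u)
push-steps z []      = ε
push-steps z (y ∷ u) with isInverse z y in inv
... | true  = CancelHead.step z y u inv ◅ ε
... | false = ε

reduce-steps : ∀ {k} (w : Word k) → Star CancelStep w (reduce w)
reduce-steps []      = ε
reduce-steps (z ∷ w) = gmap (z ∷_) (CancelUnder.step z) (reduce-steps w) ◅◅ push-steps z (reduce w)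

β-steps : ∀ {k} {w w′ : Word k} → Star CancelStep w w′ → ∀ b → IsBeta w b ⇔ IsBeta w′ b
β-steps ε       b = ⇔.refl
β-steps (S ◅ R) b = ⇔.trans (β-step S b) (β-steps R b)

lemma4 : ∀ {k : ℕ} (w : Word k) (b : Maybe ℤ) → IsBeta w b ⇔ IsBeta (reduce w) b
lemma4 w = β-steps (reduce-steps w)
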